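{- Let $n\ge5$. Every permutation $w\in S_n$ whose Robinson–Schensted recording tableau $Q(w)$ equals $\widehat Q$ has steady-state time $n-3$.
   Context: For $n\ge5$, $\widehat Q$ is the standard tableau of shape $(n-3,2,1)$ (English notation) whose first row is $1,2,5,6,\dots,n-1$, second row is $3,4$, and third row is $n$. Box-ball system (BBS): boxes are arranged in a row extending infinitely to the right, each box holds at most one ball, balls are labeled $1,\dots,n$. A permutation $w=w_1\cdots w_n$ gives the time-$0$ configuration with ball $w_i$ in the $i$-th of $n$ consecutive boxes. A BBS move moves ball $1$ to the nearest empty box to its right, then ball $2$, ..., then ball $n$; the state at time $t$ is obtained after $t$ moves. An increasing run is a maximal block of balls in consecutive boxes with labels increasing left to right; a soliton is an increasing run preserved by all subsequent BBS moves (its balls stay consecutive and in order, and the runs keep their relative order). A configuration is in steady state if all its increasing runs are solitons. The steady-state time of $w$ is the least $t\ge0$ such that the state at time $t$ is in steady state. -}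

module Defs where

open import Data.Nat using (ℕ; zero; suc; _+_; _∸_; _<_; _≤_; _≡ᵇ_; _<ᵇ_)
open import Data.Bool using (Bool; true; false; if_then_else_)
open import Data.Maybe using (Maybe; just; nothing)
open import Data.List using (List; []; _∷_; _++_; map; foldl; reverse; catMaybes; concat; applyUpTo; upTo; length)
open import Data.List.Relation.Unary.All using (All)
open import Data.List.Relation.Binary.Permutation.Propositional using (_↭_)
open import Data.Product using (_×_; _,_; proj₁; proj₂; ∃₂)
open import Relation.Binary.PropositionalEquality using (_≡_)
open import Relation.Nullary using (¬_)
open import Function using (_∘_)

-- Permutations of {1,…,n} in one-line notation

IsPerm : ℕ → List ℕ → Set
IsPerm n w = w ↭ applyUpTo suc n

-- Robinson–Schensted (row insertion); tableaux are lists of rows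

Tableau : Set
Tableau = List (List ℕ)

insertRow : ℕ → List ℕ → Maybe ℕ × List ℕ
insertRow x [] = nothing , x ∷ []
insertRow x (y ∷ ys) with x <ᵇ y
... | true  = just y , x ∷ ys
... | false with insertRow x ys
...   | b , ys' = b , y ∷ ys'

-- insert x into a tableau: returns the new tableau and the (0-based) row
-- index in which the new box was created
insertP : ℕ → Tableau → Tableau × ℕ
insertP x [] = (x ∷ []) ∷ [] , 0
insertP x (r ∷ rs) with insertRow x r
... | nothing , r' = r' ∷ rs , 0
... | just y , r' with insertP y rs
...   | rs' , i = r' ∷ rs' , suc i

addAt : ℕ → ℕ → Tableau → Tableau
addAt k i [] = (k ∷ []) ∷ []
addAt k zero (r ∷ rs) = (r ++ (k ∷ [])) ∷ rs
addAt k (suc i) (r ∷ rs) = r ∷ addAt k i rs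

-- RS with insertion/recording tableaux; the next letter gets index k
rsAux : ℕ → List ℕ → Tableau × Tableau → Tableau × Tableau
rsAux k [] PQ = PQ
rsAux k (x ∷ xs) (P , Q) with insertP x P
... | P' , i = rsAux (suc k) xs (P' , addAt k i Q)

RS : List ℕ → Tableau × Tableau
RS w = rsAux 1 w ([] , [])

recQ : List ℕ → Tableau
recQ w = proj₂ (RS w)

Qhat : ℕ → Tableau
Qhat n = (1 ∷ 2 ∷ map (λ i → i + 5) (upTo (n ∸ 5))) ∷ (3 ∷ 4 ∷ []) ∷ (n ∷ []) ∷ []

-- Box-ball system. A configuration is a finite list of boxes (nothing =
-- empty box, just b = box containing ball b), implicitly followed by
-- infinitely many empty boxes.

Config : Set
Config = List (Maybe ℕ)

place : ℕ → Config → Config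
place k [] = just k ∷ []
place k (nothing ∷ xs) = just k ∷ xs
place k (just b ∷ xs) = just b ∷ place k xs

moveBall : ℕ → Config → Config
moveBall k [] = []
moveBall k (nothing ∷ xs) = nothing ∷ moveBall k xs
moveBall k (just b ∷ xs) with b ≡ᵇ k
... | true  = nothing ∷ place k xs
... | false = just b ∷ moveBall k xs

bbsMove : ℕ → Config → Config
bbsMove n c = foldl (λ c' k → moveBall k c') c (applyUpTo suc n)

iterate : ℕ → (Config → Config) → Config → Config
iterate zero f c = c
iterate (suc t) f c = f (iterate t f c)

state : ℕ → List ℕ → ℕ → Config
state n w t = iterate t (bbsMove n) (map just w)

balls : Config → List ℕ
balls = catMaybes

-- increasing runs (maximal blocks of balls in consecutive boxes with
-- increasing labels), left to right. The accumulator is the current run reversed.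
close : List ℕ → List (List ℕ)
close [] = []
close (c ∷ cs) = reverse (c ∷ cs) ∷ []

runsAux : List ℕ → Config → List (List ℕ)
runsAux cur [] = close cur
runsAux cur (nothing ∷ xs) = close cur ++ runsAux [] xs
runsAux [] (just b ∷ xs) = runsAux (b ∷ []) xs
runsAux (c ∷ cs) (just b ∷ xs) with c <ᵇ b
... | true  = runsAux (b ∷ c ∷ cs) xs
... | false = reverse (c ∷ cs) ∷ runsAux (b ∷ []) xs

runs : Config → List (List ℕ)
runs = runsAux []

-- steady state: every increasing run of c is a soliton, i.e. after any
-- number m of further BBS moves each run still occupies consecutive boxes in
-- the same order, and the runs keep their relative order (the left-to-right
-- ball word is the concatenation of the original runs in order).
-- ys occurs as a contiguous block of xs
InfixP : {A : Set} → List A → List A → Set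
InfixP ys xs = ∃₂ λ pre suf → xs ≡ pre ++ ys ++ suf

Steady : ℕ → Config → Set
Steady n c = ∀ (m : ℕ) →
  All (λ r → InfixP (map just r) (iterate m (bbsMove n) c)) (runs c)
  × (balls (iterate m (bbsMove n) c) ≡ concat (runs c))

SteadyStateTime : ℕ → List ℕ → ℕ → Set
SteadyStateTime n w t =
  Steady n (state n w t) × (∀ s → s < t → ¬ Steady n (state n w s))

-- A BBS move equals one left-to-right pass of a carrier that row-inserts every ball it meets,
-- leaves the bumped ball in that box, and drops its smallest ball into every empty box.
-- Following row insertion letter by letter (every recording tableau met on the way is a
-- rowwise prefix of \widehat Q), a word with recording tableau \widehat Q is a b c d X z with
-- c < a < b, c < d < b, c d X increasing, and z bumping a ball y < b out of the row c d X,
-- which becomes R′. One move turns it into ∅ ∅ [a b] ∅^k [y] [R′] with k = |X| = n − 5.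
-- The pair moves two boxes per step and y one, so after k more moves they collide, leaving
-- runs [s] [u v] [R′] of increasing lengths that then separate for ever: the state at time
-- k + 2 = n − 3 is steady. Up to that time the ball word starts with a b, afterwards with
-- s u ≠ a b, while the ball word of a steady state never changes again.
module Submission where

open import Defs
open import Data.Nat
open import Data.Nat.Properties
open import Data.Bool using (true; false; T; if_then_else_)
open import Data.Unit using (tt)
open import Data.Maybe using (Maybe; just; nothing)
open import Data.List hiding (iterate)
open import Data.List.Properties
  using (foldl-++; ++-assoc; ++-identityʳ; map-++; length-++; unfold-reverse;
         length-applyUpTo; ∷-injectiveˡ; ∷-injectiveʳ; mapMaybe-just)
open import Data.List.Relation.Unary.All as All using (All; []; _∷_)
import Data.List.Relation.Unary.All.Properties as All
open import Data.List.Relation.Unary.Any using (here; there)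
open import Data.List.Relation.Unary.AllPairs using (AllPairs; []; _∷_)
import Data.List.Relation.Unary.AllPairs as AP
import Data.List.Relation.Unary.AllPairs.Properties as AllPairs
open import Data.List.Relation.Unary.Unique.Propositional using (Unique)
open import Data.List.Membership.Propositional using (_∈_; _∉_)
open import Data.List.Membership.Propositional.Properties using (∈-∃++; ∈-++⁺ˡ; ∈-++⁺ʳ; ∈-++⁻; ∈-insert)
open import Data.List.Membership.DecPropositional _≟_ using (_∈?_)
open import Data.List.Relation.Binary.Permutation.Propositional as ↭
  using (_↭_; ↭-sym; ↭-trans; ↭-reflexive; ↭⇒↭ₛ)
open import Data.List.Relation.Binary.Permutation.Propositional.Properties
  using (shift; ++⁺ˡ; ++⁺ʳ; ∈-resp-↭; ↭-length)
import Data.List.Relation.Binary.Permutation.Setoid.Properties as ↭ₛ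
open import Relation.Nullary
open import Relation.Binary.PropositionalEquality
open import Data.Product using (_×_; _,_; proj₁; proj₂; uncurry; ∃₂; ∃-syntax)
open import Data.Sum using (_⊎_; inj₁; inj₂; [_,_]′)
open import Data.Empty using (⊥-elim)
open import Function using (_∘_; _⇔_; mk⇔; Equivalence)
open import Data.List.Relation.Binary.Prefix.Heterogeneous using (Prefix; []; _∷_; _++ᵖ_)
import Data.List.Relation.Binary.Prefix.Heterogeneous.Properties as Prefix
import Data.List.Relation.Binary.Pointwise.Properties as Pointwise

Sorted : List ℕ → Set
Sorted = AllPairs _<_

≮∧≢⇒> : ∀ {x y} → ¬ x < y → x ≢ y → y < x
≮∧≢⇒> x≮y x≢y = ≤∧≢⇒< (≮⇒≥ x≮y) (≢-sym x≢y)

sorted⇒unique : ∀ {xs} → Sorted xs → Unique xs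
sorted⇒unique = AP.map <⇒≢

unique-resp-↭ : ∀ {xs ys : List ℕ} → xs ↭ ys → Unique xs → Unique ys
unique-resp-↭ p = ↭ₛ.Unique-resp-↭ (setoid ℕ) (↭⇒↭ₛ p)

sorted-upTo : ∀ n → Sorted (applyUpTo suc n)
sorted-upTo n = AllPairs.applyUpTo⁺₁ suc n (λ i<j _ → s≤s i<j)

permutation-unique : ∀ {n w} → IsPerm n w → Unique w
permutation-unique {n} perm = unique-resp-↭ (↭-sym perm) (sorted⇒unique (sorted-upTo n))

all-split : ∀ {P : ℕ → Set} pre {s} post → All P (pre ++ s ∷ post) → P s × All P (pre ++ post)
all-split []        post (ps ∷ pp) = ps , pp
all-split (_ ∷ pre) post (px ∷ pp) = let ps , pp′ = all-split pre post pp in ps , px ∷ pp′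

all-replace : ∀ {P : ℕ → Set} pre {s b} post → All P (pre ++ s ∷ post) → P b → All P (pre ++ b ∷ post)
all-replace []        post (_ ∷ pp)  pb = pb ∷ pp
all-replace (_ ∷ pre) post (px ∷ pp) pb = px ∷ all-replace pre post pp pb

sorted-split : ∀ pre {s} post → Sorted (pre ++ s ∷ post) →
  All (_< s) pre × All (s <_) post × Sorted (pre ++ post)
sorted-split []        post (s< ∷ sp) = [] , s< , sp
sorted-split (_ ∷ pre) post (x< ∷ sp) =
  let pre< , <post , sp′ = sorted-split pre post sp
      x<s , x<rest = all-split pre post x<
  in  x<s ∷ pre< , <post , x<rest ∷ sp′

sorted-replace : ∀ pre {s b} post → Sorted (pre ++ s ∷ post) → All (_< b) pre → b < s →
  Sorted (pre ++ b ∷ post)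
sorted-replace []        post (s< ∷ sp) []          b<s = All.map (<-trans b<s) s< ∷ sp
sorted-replace (_ ∷ pre) post (x< ∷ sp) (x<b ∷ pre<) b<s =
  all-replace pre post x< x<b ∷ sorted-replace pre post sp pre< b<s

sorted-∷ʳ : ∀ {S b} → Sorted S → All (_< b) S → Sorted (S ++ b ∷ [])
sorted-∷ʳ sS S<b = AllPairs.++⁺ sS ([] ∷ []) (All.map (_∷ []) S<b)

∈-remove : ∀ (pre : List ℕ) {s x} post → x ∈ pre ++ s ∷ post → x ≢ s → x ∈ pre ++ post
∈-remove []        post (here x≡s)  x≢s = ⊥-elim (x≢s x≡s)
∈-remove []        post (there x∈)  x≢s = x∈
∈-remove (_ ∷ pre) post (here x≡p)  x≢s = here x≡p
∈-remove (_ ∷ pre) post (there x∈)  x≢s = there (∈-remove pre post x∈ x≢s)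

∈-add : ∀ (pre : List ℕ) {s x} post → x ∈ pre ++ post → x ∈ pre ++ s ∷ post
∈-add []        post x∈          = there x∈
∈-add (_ ∷ pre) post (here x≡p)  = here x≡p
∈-add (_ ∷ pre) post (there x∈)  = there (∈-add pre post x∈)

unique-++-disjoint : ∀ (xs : List ℕ) {ys x} → Unique (xs ++ ys) → x ∈ xs → x ∉ ys
unique-++-disjoint (_ ∷ xs) (x∉ ∷ _) (here refl) x∈ys = All.lookup x∉ (∈-++⁺ʳ xs x∈ys) refl
unique-++-disjoint (_ ∷ xs) (_ ∷ u)  (there x∈)  x∈ys = unique-++-disjoint xs u x∈ x∈ys

insertRow-bump : ∀ {x y} ys → x < y → insertRow x (y ∷ ys) ≡ (just y , x ∷ ys)
insertRow-bump {x} {y} ys x<y with x <ᵇ y | <ᵇ-reflects-< x y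
... | true  | _       = refl
... | false | ofⁿ x≮y = ⊥-elim (x≮y x<y)

insertRow-pass : ∀ {x y ys m ys′} → ¬ x < y → insertRow x ys ≡ (m , ys′) →
  insertRow x (y ∷ ys) ≡ (m , y ∷ ys′)
insertRow-pass {x} {y} x≮y eq with x <ᵇ y | <ᵇ-reflects-< x y
... | true  | ofʸ x<y = ⊥-elim (x≮y x<y)
... | false | _       rewrite eq = refl

insertRow-append : ∀ {x} S → All (_< x) S → insertRow x S ≡ (nothing , S ++ x ∷ [])
insertRow-append []      []          = refl
insertRow-append (y ∷ S) (y<x ∷ S<x) = insertRow-pass (<⇒≯ y<x) (insertRow-append S S<x)

insertRow-bumps : ∀ {x s} lo hi → All (_< x) lo → x < s →
  insertRow x (lo ++ s ∷ hi) ≡ (just s , lo ++ x ∷ hi)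
insertRow-bumps []       hi []           x<s = insertRow-bump hi x<s
insertRow-bumps (y ∷ lo) hi (y<x ∷ lo<x) x<s = insertRow-pass (<⇒≯ y<x) (insertRow-bumps lo hi lo<x x<s)

data RowInsertion (x : ℕ) (S : List ℕ) : Set where
  appends : All (_< x) S → RowInsertion x S
  bumps   : ∀ lo s hi → S ≡ lo ++ s ∷ hi → All (_< x) lo → x < s → RowInsertion x S

rowInsertion : ∀ x S → x ∉ S → RowInsertion x S
rowInsertion x []      _   = appends []
rowInsertion x (y ∷ S) x∉ with x <? y
... | yes x<y = bumps [] y S refl [] x<y
... | no  x≮y with ≮∧≢⇒> x≮y (x∉ ∘ here) | rowInsertion x S (x∉ ∘ there)
...   | y<x | appends S<x                  = appends (y<x ∷ S<x)
...   | y<x | bumps lo s hi refl lo<x x<s  = bumps (y ∷ lo) s hi refl (y<x ∷ lo<x) x<s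

≡ᵇ-refl : ∀ k → (k ≡ᵇ k) ≡ true
≡ᵇ-refl zero    = refl
≡ᵇ-refl (suc k) = ≡ᵇ-refl k

moveBall-self : ∀ k c → moveBall k (just k ∷ c) ≡ nothing ∷ place k c
moveBall-self k c rewrite ≡ᵇ-refl k = refl

moveBall-other : ∀ {b k} c → b ≢ k → moveBall k (just b ∷ c) ≡ just b ∷ moveBall k c
moveBall-other {b} {k} c b≢k with b ≡ᵇ k in eq
... | false = refl
... | true  = ⊥-elim (b≢k (≡ᵇ⇒≡ b k (subst T (sym eq) tt)))

moveBall-absent : ∀ k c → k ∉ balls c → moveBall k c ≡ c
moveBall-absent k []            _  = refl
moveBall-absent k (nothing ∷ c) k∉ = cong (nothing ∷_) (moveBall-absent k c k∉)
moveBall-absent k (just b ∷ c)  k∉ rewrite moveBall-other c (k∉ ∘ here ∘ sym) =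
  cong (just b ∷_) (moveBall-absent k c (k∉ ∘ there))

place-map-just : ∀ k (L : List ℕ) → place k (map just L) ≡ map just (L ++ k ∷ [])
place-map-just k []      = refl
place-map-just k (x ∷ L) = cong (just x ∷_) (place-map-just k L)

balls-map-just : ∀ (L : List ℕ) → balls (map just L) ≡ L
balls-map-just = mapMaybe-just

-- One BBS move is one pass of a carrier

carryStep : Maybe ℕ → List ℕ → Maybe ℕ × List ℕ
carryStep nothing  []      = nothing , []
carryStep nothing  (s ∷ S) = just s , S
carryStep (just b) S       = insertRow b S

carry : List ℕ → Config → Config
carry S []       = map just S
carry S (x ∷ xs) = proj₁ (carryStep x S) ∷ carry (proj₂ (carryStep x S)) xs

carry-just : ∀ {m S′} b S xs → insertRow b S ≡ (m , S′) → carry S (just b ∷ xs) ≡ m ∷ carry S′ xs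
carry-just b S xs eq rewrite eq = refl

-- A ball of S counts as already lifted out of the configuration: it is only
-- dropped into the first empty box.
moveOrPlace : List ℕ → Config → ℕ → Config
moveOrPlace S c k = if does (k ∈? S) then place k c else moveBall k c

sweep : List ℕ → List ℕ → Config → Config
sweep S ks c = foldl (moveOrPlace S) c ks

sweep-++ : ∀ S xs ys c → sweep S (xs ++ ys) c ≡ sweep S ys (sweep S xs c)
sweep-++ S xs ys c = foldl-++ (moveOrPlace S) c xs ys

moveOrPlace-∈ : ∀ {k S} c → k ∈ S → moveOrPlace S c k ≡ place k c
moveOrPlace-∈ {k} {S} c k∈S with k ∈? S
... | yes _   = refl
... | no  k∉S = ⊥-elim (k∉S k∈S)

moveOrPlace-∉ : ∀ {k S} c → k ∉ S → moveOrPlace S c k ≡ moveBall k c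
moveOrPlace-∉ {k} {S} c k∉S with k ∈? S
... | yes k∈S = ⊥-elim (k∉S k∈S)
... | no  _   = refl

moveOrPlace-just : ∀ {b k S} c → b ≢ k → moveOrPlace S (just b ∷ c) k ≡ just b ∷ moveOrPlace S c k
moveOrPlace-just {k = k} {S} c b≢k with k ∈? S
... | yes _ = refl
... | no  _ = moveBall-other c b≢k

moveOrPlace-nothing : ∀ {k S} c → k ∉ S → moveOrPlace S (nothing ∷ c) k ≡ nothing ∷ moveOrPlace S c k
moveOrPlace-nothing c k∉S rewrite moveOrPlace-∉ (nothing ∷ c) k∉S | moveOrPlace-∉ c k∉S = refl

sweep-just : ∀ S ks {b} c → All (b ≢_) ks → sweep S ks (just b ∷ c) ≡ just b ∷ sweep S ks c
sweep-just S []       c []          = refl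
sweep-just S (k ∷ ks) c (b≢k ∷ b≢) rewrite moveOrPlace-just {S = S} c b≢k = sweep-just S ks _ b≢

sweep-nothing : ∀ S ks c → All (_∉ S) ks → sweep S ks (nothing ∷ c) ≡ nothing ∷ sweep S ks c
sweep-nothing S []       c []          = refl
sweep-nothing S (k ∷ ks) c (k∉S ∷ ∉S) rewrite moveOrPlace-nothing c k∉S = sweep-nothing S ks _ ∉S

sweep-cong : ∀ {S S′} ks c → All (λ k → k ∈ S ⇔ k ∈ S′) ks → sweep S ks c ≡ sweep S′ ks c
sweep-cong                []       c []        = refl
sweep-cong {S} {S′} (k ∷ ks) c (k⇔ ∷ ⇔s) = trans (cong (λ c′ → sweep S ks c′) step) (sweep-cong ks _ ⇔s)
  where
  step : moveOrPlace S c k ≡ moveOrPlace S′ c k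
  step with k ∈? S | k ∈? S′
  ... | yes _   | yes _    = refl
  ... | no  _   | no  _    = refl
  ... | yes k∈S | no  k∉S′ = ⊥-elim (k∉S′ (Equivalence.to k⇔ k∈S))
  ... | no  k∉S | yes k∈S′ = ⊥-elim (k∉S (Equivalence.from k⇔ k∈S′))

∈-replace-⇔ : ∀ (lo : List ℕ) {s b k : ℕ} hi → k ≢ s → k ≢ b → k ∈ lo ++ s ∷ hi ⇔ k ∈ lo ++ b ∷ hi
∈-replace-⇔ lo hi k≢s k≢b =
  mk⇔ (λ k∈ → ∈-add lo hi (∈-remove lo hi k∈ k≢s)) (λ k∈ → ∈-add lo hi (∈-remove lo hi k∈ k≢b))

∈-∷-⇔ : ∀ {s k : ℕ} {S} → k ≢ s → k ∈ s ∷ S ⇔ k ∈ S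
∈-∷-⇔ k≢s = mk⇔ (λ { (here k≡s) → ⊥-elim (k≢s k≡s) ; (there k∈) → k∈ }) there

∈-∷ʳ-⇔ : ∀ S {b k : ℕ} → k ≢ b → k ∈ S ⇔ k ∈ S ++ b ∷ []
∈-∷ʳ-⇔ S {b} {k} k≢b = mk⇔ ∈-++⁺ˡ from
  where
  from : k ∈ S ++ b ∷ [] → k ∈ S
  from k∈ with ∈-++⁻ S k∈
  ... | inj₁ k∈S          = k∈S
  ... | inj₂ (here k≡b)   = ⊥-elim (k≢b k≡b)

sweep-lift : ∀ S pre {b} rest c → All (_< b) pre → b ∉ S →
  sweep S (pre ++ b ∷ rest) (just b ∷ c) ≡ sweep S rest (nothing ∷ place b (sweep S pre c))
sweep-lift S pre {b} rest c pre<b b∉S = begin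
  sweep S (pre ++ b ∷ rest) (just b ∷ c)           ≡⟨ sweep-++ S pre (b ∷ rest) _ ⟩
  sweep S (b ∷ rest) (sweep S pre (just b ∷ c))    ≡⟨ cong (sweep S (b ∷ rest)) (sweep-just S pre c (All.map >⇒≢ pre<b)) ⟩
  sweep S rest (moveOrPlace S (just b ∷ d) b)      ≡⟨ cong (sweep S rest) (moveOrPlace-∉ (just b ∷ d) b∉S) ⟩
  sweep S rest (moveBall b (just b ∷ d))           ≡⟨ cong (sweep S rest) (moveBall-self b d) ⟩
  sweep S rest (nothing ∷ place b d)               ∎
  where
  open ≡-Reasoning
  d : Config
  d = sweep S pre c

sweep-drop : ∀ S pre {s} post c → All (_∉ S) pre → s ∈ S → All (s <_) post →
  sweep S (pre ++ s ∷ post) (nothing ∷ c) ≡ just s ∷ sweep S post (sweep S pre c)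
sweep-drop S pre {s} post c pre∉S s∈S s<post = begin
  sweep S (pre ++ s ∷ post) (nothing ∷ c)          ≡⟨ sweep-++ S pre (s ∷ post) _ ⟩
  sweep S (s ∷ post) (sweep S pre (nothing ∷ c))   ≡⟨ cong (sweep S (s ∷ post)) (sweep-nothing S pre c pre∉S) ⟩
  sweep S post (moveOrPlace S (nothing ∷ d) s)     ≡⟨ cong (sweep S post) (moveOrPlace-∈ (nothing ∷ d) s∈S) ⟩
  sweep S post (just s ∷ d)                        ≡⟨ sweep-just S post d (All.map <⇒≢ s<post) ⟩
  just s ∷ sweep S post d                          ∎
  where
  open ≡-Reasoning
  d : Config
  d = sweep S pre c

sweep-place : ∀ S pre {b} rest c → b ∈ S →
  sweep S (pre ++ b ∷ rest) c ≡ sweep S rest (place b (sweep S pre c))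
sweep-place S pre rest c b∈S =
  trans (sweep-++ S pre (_ ∷ rest) c) (cong (sweep S rest) (moveOrPlace-∈ (sweep S pre c) b∈S))

sorted-min : ∀ {k ks S} → Sorted (k ∷ ks) → Sorted S → All (_∈ k ∷ ks) S → k ∈ S → ∃[ S′ ] S ≡ k ∷ S′
sorted-min {S = s ∷ S} _          _          (here refl ∷ _) _          = S , refl
sorted-min             (k< ∷ _)   _          (there s∈ ∷ _)  (here k≡s) =
  ⊥-elim (<-irrefl k≡s (All.lookup k< s∈))
sorted-min             (k< ∷ _)   (s< ∷ _)   (there s∈ ∷ _)  (there k∈) =
  ⊥-elim (<-asym (All.lookup k< s∈) (All.lookup s< k∈))

sweep-end : ∀ S ks L → Sorted ks → Sorted S → All (_∈ ks) S → All (_∉ L) ks →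
  sweep S ks (map just L) ≡ map just (L ++ S)
sweep-end []      []       L _ _ []      _ = cong (map just) (sym (++-identityʳ L))
sweep-end (_ ∷ _) []       L _ _ (() ∷ _) _
sweep-end S       (k ∷ ks) L (k< ∷ sks) sS S⊆ (k∉L ∷ ks∉L) with k ∈? S
... | no k∉S = begin
  sweep S ks (moveBall k (map just L))  ≡⟨ cong (sweep S ks) (moveBall-absent k (map just L) k∉balls) ⟩
  sweep S ks (map just L)               ≡⟨ sweep-end S ks L sks sS S⊆ks ks∉L ⟩
  map just (L ++ S)                     ∎
  where
  open ≡-Reasoning
  k∉balls : k ∉ balls (map just L)
  k∉balls = subst (k ∉_) (sym (balls-map-just L)) k∉L
  S⊆ks : All (_∈ ks) S
  S⊆ks = All.tabulate λ {x} x∈S → ∈-remove [] ks (All.lookup S⊆ x∈S) λ { refl → k∉S x∈S }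
... | yes k∈S with sorted-min (k< ∷ sks) sS S⊆ k∈S
...   | S′ , refl = begin
  sweep (k ∷ S′) ks (place k (map just L))       ≡⟨ cong (sweep (k ∷ S′) ks) (place-map-just k L) ⟩
  sweep (k ∷ S′) ks (map just (L ++ k ∷ []))     ≡⟨ sweep-cong {S′ = S′} ks _ (All.map (∈-∷-⇔ ∘ >⇒≢) k<) ⟩
  sweep S′ ks (map just (L ++ k ∷ []))           ≡⟨ sweep-end S′ ks (L ++ k ∷ []) sks sS′ S′⊆ks ks∉Lk ⟩
  map just ((L ++ k ∷ []) ++ S′)                 ≡⟨ cong (map just) (++-assoc L (k ∷ []) S′) ⟩
  map just (L ++ k ∷ S′)                         ∎
  where
  open ≡-Reasoning
  sS′ : Sorted S′
  sS′ = AP.tail sS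
  S′⊆ks : All (_∈ ks) S′
  S′⊆ks = All.zipWith (λ (x∈ , k<x) → ∈-remove [] ks x∈ (>⇒≢ k<x)) (All.tail S⊆ , AP.head sS)
  ks∉Lk : All (_∉ L ++ k ∷ []) ks
  ks∉Lk = All.zipWith (λ (x∉L , k<x) x∈ → [ x∉L , (λ { (here refl) → <-irrefl refl k<x }) ]′ (∈-++⁻ L x∈))
                      (ks∉L , k<)

⊆-remove : ∀ pre {s} post {xs} → All (_∈ pre ++ s ∷ post) xs → s ∉ xs → All (_∈ pre ++ post) xs
⊆-remove pre post ⊆ks s∉ =
  All.tabulate λ x∈ → ∈-remove pre post (All.lookup ⊆ks x∈) λ { refl → s∉ x∈ }

record Admissible (ks S : List ℕ) (c : Config) : Set where
  field
    labels-sorted   : Sorted ks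
    carried-sorted  : Sorted S
    carried⊆labels  : All (_∈ ks) S
    balls⊆labels    : All (_∈ ks) (balls c)
    carried-unique  : Unique (S ++ balls c)

SweepIsCarry : Config → Set
SweepIsCarry c = ∀ {ks S} → Admissible ks S c → sweep S ks c ≡ carry S c

sweep≡carry-drop : ∀ {c} → SweepIsCarry c → ∀ {ks s S} → Admissible ks (s ∷ S) (nothing ∷ c) →
  sweep (s ∷ S) ks (nothing ∷ c) ≡ just s ∷ carry S c
sweep≡carry-drop {c} ih {ks} {s} {S} adm with ∈-∃++ (All.head carried⊆labels)
  where open Admissible adm
... | pre , post , refl with sorted-split pre post labels-sorted
  where open Admissible adm
...   | pre<s , s<post , sorted′ = begin
  sweep (s ∷ S) (pre ++ s ∷ post) (nothing ∷ c)
    ≡⟨ sweep-drop (s ∷ S) pre post c (All.map pre∉S pre<s) (here refl) s<post ⟩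
  just s ∷ sweep (s ∷ S) post (sweep (s ∷ S) pre c)
    ≡⟨ cong (just s ∷_) (trans
         (cong (sweep (s ∷ S) post) (sweep-cong {S′ = S} pre c (All.map (∈-∷-⇔ ∘ <⇒≢) pre<s)))
         (sweep-cong {S′ = S} post _ (All.map (∈-∷-⇔ ∘ >⇒≢) s<post))) ⟩
  just s ∷ sweep S post (sweep S pre c)
    ≡⟨ cong (just s ∷_) (sym (sweep-++ S pre post c)) ⟩
  just s ∷ sweep S (pre ++ post) c
    ≡⟨ cong (just s ∷_) (ih adm′) ⟩
  just s ∷ carry S c ∎
  where
  open ≡-Reasoning
  open Admissible adm
  s<S : All (s <_) S
  s<S = AP.head carried-sorted
  pre∉S : ∀ {x} → x < s → x ∉ s ∷ S
  pre∉S x<s (here refl) = <-irrefl refl x<s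
  pre∉S x<s (there x∈S) = <-asym x<s (All.lookup s<S x∈S)
  adm′ : Admissible (pre ++ post) S c
  adm′ = record
    { labels-sorted  = sorted′
    ; carried-sorted = AP.tail carried-sorted
    ; carried⊆labels = ⊆-remove pre post (All.tail carried⊆labels) (λ s∈S → <-irrefl refl (All.lookup s<S s∈S))
    ; balls⊆labels   = ⊆-remove pre post balls⊆labels (λ s∈c → All.lookup (AP.head carried-unique) (∈-++⁺ʳ S s∈c) refl)
    ; carried-unique = AP.tail carried-unique
    }

sweep≡carry-append : ∀ {c} → SweepIsCarry c → ∀ {ks b S} → Admissible ks S (just b ∷ c) → All (_< b) S →
  sweep S ks (just b ∷ c) ≡ nothing ∷ carry (S ++ b ∷ []) c
sweep≡carry-append {c} ih {ks} {b} {S} adm S<b with ∈-∃++ (All.head balls⊆labels)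
  where open Admissible adm
... | pre , post , refl with sorted-split pre post labels-sorted
  where open Admissible adm
...   | pre<b , b<post , _ = begin
  sweep S (pre ++ b ∷ post) (just b ∷ c)
    ≡⟨ sweep-lift S pre post c pre<b b∉S ⟩
  sweep S post (nothing ∷ place b (sweep S pre c))
    ≡⟨ sweep-nothing S post _ (All.map (λ b<x x∈S → <-asym b<x (All.lookup S<b x∈S)) b<post) ⟩
  nothing ∷ sweep S post (place b (sweep S pre c))
    ≡⟨ cong (nothing ∷_) (trans
         (cong (λ d → sweep S post (place b d)) (sweep-cong {S′ = S′} pre c (All.map (∈-∷ʳ-⇔ S ∘ <⇒≢) pre<b)))
         (sweep-cong {S′ = S′} post _ (All.map (∈-∷ʳ-⇔ S ∘ >⇒≢) b<post))) ⟩
  nothing ∷ sweep S′ post (place b (sweep S′ pre c))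
    ≡⟨ cong (nothing ∷_) (sym (sweep-place S′ pre post c (∈-++⁺ʳ S (here refl)))) ⟩
  nothing ∷ sweep S′ (pre ++ b ∷ post) c
    ≡⟨ cong (nothing ∷_) (ih adm′) ⟩
  nothing ∷ carry S′ c ∎
  where
  open ≡-Reasoning
  open Admissible adm
  S′ : List ℕ
  S′ = S ++ b ∷ []
  b∉S : b ∉ S
  b∉S b∈S = unique-++-disjoint S carried-unique b∈S (here refl)
  adm′ : Admissible (pre ++ b ∷ post) S′ c
  adm′ = record
    { labels-sorted  = labels-sorted
    ; carried-sorted = sorted-∷ʳ carried-sorted S<b
    ; carried⊆labels = All.++⁺ carried⊆labels (All.head balls⊆labels ∷ [])
    ; balls⊆labels   = All.tail balls⊆labels
    ; carried-unique = subst Unique (sym (++-assoc S (b ∷ []) (balls c))) carried-unique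
    }

exchange-↭ : ∀ (lo : List ℕ) s hi b bc → (lo ++ s ∷ hi) ++ b ∷ bc ↭ s ∷ ((lo ++ b ∷ hi) ++ bc)
exchange-↭ lo s hi b bc = begin
  (lo ++ s ∷ hi) ++ b ∷ bc    ≡⟨ ++-assoc lo (s ∷ hi) (b ∷ bc) ⟩
  lo ++ s ∷ hi ++ b ∷ bc      ↭⟨ shift s lo (hi ++ b ∷ bc) ⟩
  s ∷ lo ++ hi ++ b ∷ bc      ↭⟨ ↭.prep s (++⁺ˡ lo (shift b hi bc)) ⟩
  s ∷ lo ++ b ∷ hi ++ bc      ≡⟨ cong (s ∷_) (++-assoc lo (b ∷ hi) bc) ⟨
  s ∷ (lo ++ b ∷ hi) ++ bc    ∎
  where open ↭.PermutationReasoning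

sorted-++⁻ˡ : ∀ xs {ys} → Sorted (xs ++ ys) → Sorted xs
sorted-++⁻ˡ []       _          = []
sorted-++⁻ˡ (_ ∷ xs) (x< ∷ sxs) = All.++⁻ˡ xs x< ∷ sorted-++⁻ˡ xs sxs

data Straddle (b s : ℕ) : List ℕ → Set where
  straddle : ∀ pre p₁ p₂ → All (_< b) pre → All (b <_) p₁ → All (_< s) p₁ → All (s <_) p₂ →
    Sorted ((pre ++ b ∷ p₁) ++ p₂) → Straddle b s ((pre ++ b ∷ p₁) ++ s ∷ p₂)

straddle-view : ∀ {ks b s} → Sorted ks → b ∈ ks → s ∈ ks → b < s → Straddle b s ks
straddle-view {b = b} {s} sorted b∈ s∈ b<s with ∈-∃++ s∈
... | K , p₂ , refl with sorted-split K p₂ sorted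
...   | K<s , s<p₂ , sorted′ with ∈-∃++ b∈K
  where
  b∈K : b ∈ K
  b∈K with ∈-++⁻ K b∈
  ... | inj₁ b∈K′           = b∈K′
  ... | inj₂ (here b≡s)     = ⊥-elim (<-irrefl b≡s b<s)
  ... | inj₂ (there b∈p₂)   = ⊥-elim (<-asym b<s (All.lookup s<p₂ b∈p₂))
...     | pre , p₁ , refl =
  let pre<b , b<p₁ , _ = sorted-split pre p₁ (sorted-++⁻ˡ (pre ++ b ∷ p₁) sorted′)
  in  straddle pre p₁ p₂ pre<b b<p₁ (All.tail (All.++⁻ʳ pre K<s)) s<p₂ sorted′

admissible-bump : ∀ {c b s} pre p₁ p₂ lo hi → Admissible ((pre ++ b ∷ p₁) ++ s ∷ p₂) (lo ++ s ∷ hi) (just b ∷ c) →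
  Sorted ((pre ++ b ∷ p₁) ++ p₂) → All (_< b) lo → b < s → Admissible ((pre ++ b ∷ p₁) ++ p₂) (lo ++ b ∷ hi) c
admissible-bump {c} {b} {s} pre p₁ p₂ lo hi adm sorted lo<b b<s = record
  { labels-sorted  = sorted
  ; carried-sorted = sorted-replace lo hi carried-sorted lo<b b<s
  ; carried⊆labels = All.++⁺ (All.++⁻ˡ lo lo++hi⊆) (∈-++⁺ˡ (∈-insert pre) ∷ All.++⁻ʳ lo lo++hi⊆)
  ; balls⊆labels   = ⊆-remove K p₂ (All.tail balls⊆labels) s∉balls
  ; carried-unique = AP.tail (unique-resp-↭ (exchange-↭ lo s hi b (balls c)) carried-unique)
  }
  where
  open Admissible adm
  K : List ℕ
  K = pre ++ b ∷ p₁
  lo<s : All (_< s) lo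
  lo<s = proj₁ (sorted-split lo hi carried-sorted)
  s<hi : All (s <_) hi
  s<hi = proj₁ (proj₂ (sorted-split lo hi carried-sorted))
  s∉lo++hi : s ∉ lo ++ hi
  s∉lo++hi s∈ with ∈-++⁻ lo s∈
  ... | inj₁ s∈lo = <-irrefl refl (All.lookup lo<s s∈lo)
  ... | inj₂ s∈hi = <-irrefl refl (All.lookup s<hi s∈hi)
  lo++hi⊆ : All (_∈ K ++ p₂) (lo ++ hi)
  lo++hi⊆ = ⊆-remove K p₂ (proj₂ (all-split lo hi carried⊆labels)) s∉lo++hi
  s∉balls : s ∉ balls c
  s∉balls s∈c = unique-++-disjoint (lo ++ s ∷ hi) carried-unique (∈-insert lo) (there s∈c)

sweep≡carry-bump : ∀ {c} → SweepIsCarry c → ∀ {ks b} lo {s} hi → Admissible ks (lo ++ s ∷ hi) (just b ∷ c) →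
  All (_< b) lo → b < s → sweep (lo ++ s ∷ hi) ks (just b ∷ c) ≡ just s ∷ carry (lo ++ b ∷ hi) c
sweep≡carry-bump {c} ih {ks} {b} lo {s} hi adm lo<b b<s
  with straddle-view labels-sorted (All.head balls⊆labels) (All.lookup carried⊆labels (∈-insert lo)) b<s
  where open Admissible adm
... | straddle pre p₁ p₂ pre<b b<p₁ p₁<s s<p₂ sorted = begin
  sweep S ((pre ++ b ∷ p₁) ++ s ∷ p₂) (just b ∷ c)
    ≡⟨ sweep-++ S (pre ++ b ∷ p₁) (s ∷ p₂) _ ⟩
  sweep S (s ∷ p₂) (sweep S (pre ++ b ∷ p₁) (just b ∷ c))
    ≡⟨ cong (sweep S (s ∷ p₂)) (sweep-lift S pre p₁ c pre<b b∉S) ⟩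
  sweep S (s ∷ p₂) (sweep S p₁ (nothing ∷ place b (sweep S pre c)))
    ≡⟨ cong (sweep S (s ∷ p₂)) (sweep-nothing S p₁ _ (All.zipWith (uncurry p₁∉S) (b<p₁ , p₁<s))) ⟩
  sweep S (s ∷ p₂) (nothing ∷ sweep S p₁ (place b (sweep S pre c)))
    ≡⟨ sweep-drop S [] p₂ _ [] (∈-insert lo) s<p₂ ⟩
  just s ∷ sweep S p₂ (sweep S p₁ (place b (sweep S pre c)))
    ≡⟨ cong (just s ∷_) exchange ⟩
  just s ∷ sweep S′ p₂ (sweep S′ p₁ (place b (sweep S′ pre c)))
    ≡⟨ cong (λ d → just s ∷ sweep S′ p₂ d) (sweep-place S′ pre p₁ c (∈-insert lo)) ⟨
  just s ∷ sweep S′ p₂ (sweep S′ (pre ++ b ∷ p₁) c)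
    ≡⟨ cong (just s ∷_) (sweep-++ S′ (pre ++ b ∷ p₁) p₂ c) ⟨
  just s ∷ sweep S′ ((pre ++ b ∷ p₁) ++ p₂) c
    ≡⟨ cong (just s ∷_) (ih (admissible-bump pre p₁ p₂ lo hi adm sorted lo<b b<s)) ⟩
  just s ∷ carry S′ c ∎
  where
  open ≡-Reasoning
  open Admissible adm
  S S′ : List ℕ
  S = lo ++ s ∷ hi
  S′ = lo ++ b ∷ hi
  b∉S : b ∉ S
  b∉S b∈S = unique-++-disjoint S carried-unique b∈S (here refl)
  s<hi : All (s <_) hi
  s<hi = proj₁ (proj₂ (sorted-split lo hi carried-sorted))
  p₁∉S : ∀ {x} → b < x → x < s → x ∉ S
  p₁∉S b<x x<s x∈S with ∈-++⁻ lo x∈S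
  ... | inj₁ x∈lo          = <-asym b<x (All.lookup lo<b x∈lo)
  ... | inj₂ (here refl)   = <-irrefl refl x<s
  ... | inj₂ (there x∈hi)  = <-asym x<s (All.lookup s<hi x∈hi)
  swap-b-s : ∀ {x} → x ≢ s → x ≢ b → x ∈ S ⇔ x ∈ S′
  swap-b-s = ∈-replace-⇔ lo hi
  exchange : sweep S p₂ (sweep S p₁ (place b (sweep S pre c))) ≡ sweep S′ p₂ (sweep S′ p₁ (place b (sweep S′ pre c)))
  exchange = begin
    sweep S p₂ (sweep S p₁ (place b (sweep S pre c)))
      ≡⟨ sweep-cong p₂ _ (All.map (λ s<x → swap-b-s (>⇒≢ s<x) (>⇒≢ (<-trans b<s s<x))) s<p₂) ⟩
    sweep S′ p₂ (sweep S p₁ (place b (sweep S pre c)))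
      ≡⟨ cong (sweep S′ p₂)
              (sweep-cong p₁ _ (All.zipWith (λ (b<x , x<s) → swap-b-s (<⇒≢ x<s) (>⇒≢ b<x)) (b<p₁ , p₁<s))) ⟩
    sweep S′ p₂ (sweep S′ p₁ (place b (sweep S pre c)))
      ≡⟨ cong (λ d → sweep S′ p₂ (sweep S′ p₁ (place b d)))
              (sweep-cong pre c (All.map (λ x<b → swap-b-s (<⇒≢ (<-trans x<b b<s)) (<⇒≢ x<b)) pre<b)) ⟩
    sweep S′ p₂ (sweep S′ p₁ (place b (sweep S′ pre c))) ∎

sweep≡carry : ∀ c → SweepIsCarry c
sweep≡carry [] {ks} {S} adm = sweep-end S ks [] labels-sorted carried-sorted carried⊆labels (All.tabulate λ _ ())
  where open Admissible adm
sweep≡carry (nothing ∷ c) {ks} {[]} adm =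
  trans (sweep-nothing [] ks c (All.tabulate λ _ ())) (cong (nothing ∷_) (sweep≡carry c adm′))
  where
  open Admissible adm
  adm′ : Admissible ks [] c
  adm′ = record { labels-sorted = labels-sorted ; carried-sorted = [] ; carried⊆labels = []
                ; balls⊆labels = balls⊆labels ; carried-unique = carried-unique }
sweep≡carry (nothing ∷ c) {S = _ ∷ _} adm = sweep≡carry-drop (sweep≡carry c) adm
sweep≡carry (just b ∷ c) {S = S} adm with rowInsertion b S (λ b∈S → unique-++-disjoint S carried-unique b∈S (here refl))
  where open Admissible adm
... | appends S<b =
  trans (sweep≡carry-append (sweep≡carry c) adm S<b) (sym (carry-just b S c (insertRow-append S S<b)))
... | bumps lo s hi refl lo<b b<s =
  trans (sweep≡carry-bump (sweep≡carry c) lo hi adm lo<b b<s)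
        (sym (carry-just b (lo ++ s ∷ hi) c (insertRow-bumps lo hi lo<b b<s)))

fromMaybe-insertRow : ∀ x ys → fromMaybe (proj₁ (insertRow x ys)) ++ proj₂ (insertRow x ys) ↭ x ∷ ys
fromMaybe-insertRow x [] = ↭.refl
fromMaybe-insertRow x (y ∷ ys) with x <ᵇ y
... | true  = ↭.swap y x ↭.refl
... | false with insertRow x ys | fromMaybe-insertRow x ys
...   | nothing , ys′ | ih = ↭.trans (↭.prep y ih) (↭.swap y x ↭.refl)
...   | just z  , ys′ | ih = ↭.trans (↭.swap z y ↭.refl) (↭.trans (↭.prep y ih) (↭.swap y x ↭.refl))

balls-∷ : ∀ m xs → balls (m ∷ xs) ≡ fromMaybe m ++ balls xs
balls-∷ nothing  xs = refl
balls-∷ (just x) xs = refl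

balls-carry : ∀ S c → balls (carry S c) ↭ S ++ balls c
balls-carry S       []            = ↭-reflexive (trans (balls-map-just S) (sym (++-identityʳ S)))
balls-carry []      (nothing ∷ c) = balls-carry [] c
balls-carry (s ∷ S) (nothing ∷ c) = ↭.prep s (balls-carry S c)
balls-carry S       (just b ∷ c)  = begin
  balls (m ∷ carry S′ c)      ≡⟨ balls-∷ m (carry S′ c) ⟩
  fromMaybe m ++ balls (carry S′ c)   ↭⟨ ++⁺ˡ (fromMaybe m) (balls-carry S′ c) ⟩
  fromMaybe m ++ S′ ++ balls c        ≡⟨ ++-assoc (fromMaybe m) S′ (balls c) ⟨
  (fromMaybe m ++ S′) ++ balls c      ↭⟨ ++⁺ʳ (balls c) (fromMaybe-insertRow b S) ⟩
  b ∷ S ++ balls c                    ↭⟨ shift b S (balls c) ⟨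
  S ++ b ∷ balls c                    ∎
  where
  open ↭.PermutationReasoning
  m : Maybe ℕ
  m = proj₁ (insertRow b S)
  S′ : List ℕ
  S′ = proj₂ (insertRow b S)

bbsMove≡carry : ∀ n c → IsPerm n (balls c) → bbsMove n c ≡ carry [] c
bbsMove≡carry n c bc = sweep≡carry c record
  { labels-sorted  = sorted-upTo n
  ; carried-sorted = []
  ; carried⊆labels = []
  ; balls⊆labels   = All.tabulate (∈-resp-↭ bc)
  ; carried-unique = unique-resp-↭ (↭-sym bc) (sorted⇒unique (sorted-upTo n))
  }

isPerm-iterate-carry : ∀ {n} c → IsPerm n (balls c) → ∀ t → IsPerm n (balls (iterate t (carry []) c))
isPerm-iterate-carry c bc zero    = bc
isPerm-iterate-carry c bc (suc t) = ↭-trans (balls-carry [] (iterate t (carry []) c)) (isPerm-iterate-carry c bc t)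

iterate-bbsMove≡carry : ∀ n c → IsPerm n (balls c) → ∀ t → iterate t (bbsMove n) c ≡ iterate t (carry []) c
iterate-bbsMove≡carry n c bc zero    = refl
iterate-bbsMove≡carry n c bc (suc t) =
  trans (cong (bbsMove n) (iterate-bbsMove≡carry n c bc t)) (bbsMove≡carry n _ (isPerm-iterate-carry c bc t))

-- Words whose recording tableau is \widehat Q

_≼_ : Tableau → Tableau → Set
_≼_ = Prefix (Prefix _≡_)

row-refl : ∀ {r : List ℕ} → Prefix _≡_ r r
row-refl = Prefix.fromPointwise (Pointwise.refl refl)

≼-refl : ∀ {Q} → Q ≼ Q
≼-refl = Prefix.fromPointwise (Pointwise.refl row-refl)

≼-trans : ∀ {Q₁ Q₂ Q₃} → Q₁ ≼ Q₂ → Q₂ ≼ Q₃ → Q₁ ≼ Q₃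
≼-trans = Prefix.trans (Prefix.trans trans)

≼-addAt : ∀ k i Q → Q ≼ addAt k i Q
≼-addAt k i       []      = []
≼-addAt k zero    (r ∷ Q) = (row-refl ++ᵖ (k ∷ [])) ∷ ≼-refl
≼-addAt k (suc i) (r ∷ Q) = row-refl ∷ ≼-addAt k i Q

≼-rsAux : ∀ k xs P Q → Q ≼ proj₂ (rsAux k xs (P , Q))
≼-rsAux k []       P Q = ≼-refl
≼-rsAux k (x ∷ xs) P Q with insertP x P
... | P′ , i = ≼-trans (≼-addAt k i Q) (≼-rsAux (suc k) xs P′ (addAt k i Q))

record EndsInQhat (n k : ℕ) (xs : List ℕ) (P Q : Tableau) : Set where
  constructor endsInQhat
  field recQ≡Qhat : proj₂ (rsAux k xs (P , Q)) ≡ Qhat n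

endsInQhat-step : ∀ {n k x xs P Q P′ i} → insertP x P ≡ (P′ , i) → EndsInQhat n k (x ∷ xs) P Q →
  EndsInQhat n (suc k) xs P′ (addAt k i Q)
endsInQhat-step eq (endsInQhat r) rewrite eq = endsInQhat r

endsInQhat-≼ : ∀ {n k xs P Q} → EndsInQhat n k xs P Q → Q ≼ Qhat n
endsInQhat-≼ {k = k} {xs} {P} {Q} (endsInQhat r) = subst (Q ≼_) r (≼-rsAux k xs P Q)

insertP-new : ∀ {x r r′} rs → insertRow x r ≡ (nothing , r′) → insertP x (r ∷ rs) ≡ (r′ ∷ rs , 0)
insertP-new rs eq rewrite eq = refl

insertP-bump : ∀ {x r r′ y rs rs′ i} → insertRow x r ≡ (just y , r′) → insertP y rs ≡ (rs′ , i) →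
  insertP x (r ∷ rs) ≡ (r′ ∷ rs′ , suc i)
insertP-bump eq eq′ rewrite eq | eq′ = refl

insertRow-just : ∀ x r {y r′} → insertRow x r ≡ (just y , r′) → x < y × y ∈ r
insertRow-just x []      ()
insertRow-just x (z ∷ r) eq with x <ᵇ z | <ᵇ-reflects-< x z | eq
... | true  | ofʸ x<z | refl = x<z , here refl
... | false | _       | eq′ with insertRow x r in eq″
insertRow-just x (z ∷ r) _ | false | _ | refl | just y , _ = let x<y , y∈ = insertRow-just x r eq″ in x<y , there y∈

Qhat-row₀-tail : ∀ m {x xs} → x ≢ 5 → ¬ Prefix _≡_ (x ∷ xs) (map (λ i → i + 5) (upTo m))
Qhat-row₀-tail zero    x≢5 ()
Qhat-row₀-tail (suc m) x≢5 (x≡5 ∷ _) = x≢5 x≡5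

second-letter : ∀ {n a b xs} → a ≢ b → EndsInQhat n 2 (b ∷ xs) ((a ∷ []) ∷ []) ((1 ∷ []) ∷ []) →
  a < b × EndsInQhat n 3 xs ((a ∷ b ∷ []) ∷ []) ((1 ∷ 2 ∷ []) ∷ [])
second-letter {a = a} {b} a≢b r with b <? a
... | yes b<a with endsInQhat-≼ (endsInQhat-step (insertP-bump (insertRow-bump [] b<a) refl) r)
...   | _ ∷ (() ∷ _) ∷ _
second-letter {a = a} {b} a≢b r | no b≮a =
  ≮∧≢⇒> b≮a (a≢b ∘ sym) , endsInQhat-step (insertP-new [] (insertRow-pass b≮a refl)) r

Q₃ : Tableau
Q₃ = (1 ∷ 2 ∷ []) ∷ (3 ∷ []) ∷ []

third-letter : ∀ {n a b c xs} → c ≢ a → c ≢ b → a < b →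
  EndsInQhat n 3 (c ∷ xs) ((a ∷ b ∷ []) ∷ []) ((1 ∷ 2 ∷ []) ∷ []) →
  (c < a × EndsInQhat n 4 xs ((c ∷ b ∷ []) ∷ (a ∷ []) ∷ []) Q₃)
  ⊎ (a < c × c < b × EndsInQhat n 4 xs ((a ∷ c ∷ []) ∷ (b ∷ []) ∷ []) Q₃)
third-letter {n} {a} {b} {c} c≢a c≢b a<b r with c <? a | c <? b
... | yes c<a | _       = inj₁ (c<a , endsInQhat-step (insertP-bump (insertRow-bump (b ∷ []) c<a) refl) r)
... | no  c≮a | yes c<b =
  inj₂ (≮∧≢⇒> c≮a c≢a , c<b , endsInQhat-step (insertP-bump (insertRow-pass c≮a (insertRow-bump [] c<b)) refl) r)
... | no  c≮a | no  c≮b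
  with endsInQhat-≼ (endsInQhat-step (insertP-new [] (insertRow-pass c≮a (insertRow-pass c≮b refl))) r)
...   | (_ ∷ _ ∷ 3≼) ∷ _ = ⊥-elim (Qhat-row₀-tail (n ∸ 5) (λ ()) 3≼)

Q₄ : Tableau
Q₄ = (1 ∷ 2 ∷ []) ∷ (3 ∷ 4 ∷ []) ∷ []

fourth-letter : ∀ {n a b c d xs} → 5 ≤ n → d ≢ c → c < a → a < b →
  EndsInQhat n 4 (d ∷ xs) ((c ∷ b ∷ []) ∷ (a ∷ []) ∷ []) Q₃ →
  c < d × d < b × EndsInQhat n 5 xs ((c ∷ d ∷ []) ∷ (a ∷ b ∷ []) ∷ []) Q₄
fourth-letter {n} {a} {b} {c} {d} 5≤n d≢c c<a a<b r with d <? c | d <? b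
... | yes d<c | _
  with endsInQhat-≼ (endsInQhat-step (insertP-bump (insertRow-bump (b ∷ []) d<c) (insertP-bump (insertRow-bump [] c<a) refl)) r)
...   | _ ∷ _ ∷ (4≡n ∷ _) ∷ _ = ⊥-elim (<-irrefl 4≡n 5≤n)
fourth-letter {n} {a} {b} {c} {d} 5≤n d≢c c<a a<b r | no d≮c | yes d<b =
  ≮∧≢⇒> d≮c d≢c , d<b ,
  endsInQhat-step (insertP-bump (insertRow-pass d≮c (insertRow-bump [] d<b)) (insertP-new [] (insertRow-pass (<⇒≯ a<b) refl))) r
fourth-letter {n} {a} {b} {c} {d} 5≤n d≢c c<a a<b r | no d≮c | no d≮b
  with endsInQhat-≼ (endsInQhat-step (insertP-new _ (insertRow-pass d≮c (insertRow-pass d≮b refl))) r)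
...   | (_ ∷ _ ∷ 4≼) ∷ _ = ⊥-elim (Qhat-row₀-tail (n ∸ 5) (λ ()) 4≼)

middle-third-letter-impossible : ∀ {n a b c d xs} → 5 ≤ n → d ≢ a → d ≢ c → a < c → c < b →
  ¬ EndsInQhat n 4 (d ∷ xs) ((a ∷ c ∷ []) ∷ (b ∷ []) ∷ []) Q₃
middle-third-letter-impossible {n} {a} {b} {c} {d} 5≤n d≢a d≢c a<c c<b r with d <? a | d <? c
... | yes d<a | _
  with endsInQhat-≼ (endsInQhat-step
         (insertP-bump (insertRow-bump (c ∷ []) d<a) (insertP-bump (insertRow-bump [] (<-trans a<c c<b)) refl)) r)
...   | _ ∷ _ ∷ (4≡n ∷ _) ∷ _ = <-irrefl 4≡n 5≤n
middle-third-letter-impossible {n} {a} {b} {c} {d} 5≤n d≢a d≢c a<c c<b r | no d≮a | yes d<c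
  with endsInQhat-≼ (endsInQhat-step
         (insertP-bump (insertRow-pass d≮a (insertRow-bump [] d<c)) (insertP-bump (insertRow-bump [] c<b) refl)) r)
...   | _ ∷ _ ∷ (4≡n ∷ _) ∷ _ = <-irrefl 4≡n 5≤n
middle-third-letter-impossible {n} {a} {b} {c} {d} 5≤n d≢a d≢c a<c c<b r | no d≮a | no d≮c
  with endsInQhat-≼ (endsInQhat-step (insertP-new _ (insertRow-pass d≮a (insertRow-pass d≮c refl))) r)
...   | (_ ∷ _ ∷ 4≼) ∷ _ = Qhat-row₀-tail (n ∸ 5) (λ ()) 4≼

data EndsWithBump (row : List ℕ) (b : ℕ) : List ℕ → Set where
  endsWithBump : ∀ X {z y} lo hi → Sorted (row ++ X) → row ++ X ≡ lo ++ y ∷ hi → All (_< z) lo → z < y → y < b →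
    EndsWithBump row b (X ++ z ∷ [])

last-letter : ∀ n (xs : List ℕ) → n + suc (length xs) ≡ suc n → xs ≡ []
last-letter n []      eq = refl
last-letter n (_ ∷ _) eq with +-cancelˡ-≡ n _ _ (trans eq (sym (+-comm n 1)))
... | ()

remaining-letters : ∀ {n a b} → a < b → ∀ xs row ys k → k + length xs ≡ suc n → Sorted row → Unique (row ++ xs) →
  EndsInQhat n k xs (row ∷ (a ∷ b ∷ []) ∷ []) ((1 ∷ 2 ∷ ys) ∷ (3 ∷ 4 ∷ []) ∷ []) → EndsWithBump row b xs
remaining-letters a<b [] row ys k len sorted u (endsInQhat ())
remaining-letters {n} {a} {b} a<b (x ∷ xs) row ys k len sorted u r
  with rowInsertion x row (λ x∈row → unique-++-disjoint row u x∈row (here refl))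
... | appends row<x
  with remaining-letters a<b xs (row ++ x ∷ []) (ys ++ k ∷ []) (suc k) (trans (sym (+-suc k (length xs))) len)
         (sorted-∷ʳ sorted row<x) (subst Unique (sym (++-assoc row (x ∷ []) xs)) u)
         (endsInQhat-step (insertP-new {x} {row} _ (insertRow-append row row<x)) r)
...   | endsWithBump X lo hi sorted′ row≡ lo<z z<y y<b =
  endsWithBump (x ∷ X) lo hi (subst Sorted (++-assoc row (x ∷ []) X) sorted′)
    (trans (sym (++-assoc row (x ∷ []) X)) row≡) lo<z z<y y<b
remaining-letters {n} {a} {b} a<b (x ∷ xs) row ys k len sorted u r | bumps lo s hi refl lo<x x<s
  with insertRow s (a ∷ b ∷ []) in eq
... | nothing , _
  with endsInQhat-≼ (endsInQhat-step (insertP-bump {x} {lo ++ s ∷ hi} (insertRow-bumps lo hi lo<x x<s) (insertP-new [] eq)) r)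
...   | _ ∷ (_ ∷ _ ∷ () ) ∷ _
remaining-letters {n} {a} {b} a<b (x ∷ xs) row ys k len sorted u r | bumps lo s hi refl lo<x x<s | just e , _
  with endsInQhat-≼ (endsInQhat-step (insertP-bump {x} {lo ++ s ∷ hi} (insertRow-bumps lo hi lo<x x<s) (insertP-bump eq refl)) r)
...   | _ ∷ _ ∷ (refl ∷ _) ∷ _ rewrite last-letter n xs len =
  endsWithBump [] lo hi (subst Sorted (sym (++-identityʳ row)) sorted) (++-identityʳ row) lo<x x<s s<b
  where
  s<b : s < b
  s<b with insertRow-just s (a ∷ b ∷ []) eq
  ... | s<a , here refl         = <-trans s<a a<b
  ... | s<b , there (here refl) = s<b

data QhatWord : List ℕ → Set where
  qhatWord : ∀ {a b c d X z y} lo hi → c < a → a < b → c < d → d < b → Sorted (c ∷ d ∷ X) →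
    c ∷ d ∷ X ≡ lo ++ y ∷ hi → All (_< z) lo → z < y → y < b → QhatWord (a ∷ b ∷ c ∷ d ∷ X ++ z ∷ [])

inversion : ∀ w → 5 ≤ length w → Unique w → recQ w ≡ Qhat (length w) → QhatWord w
inversion (a ∷ b ∷ c ∷ d ∷ rest) 5≤n
  u@((a≢b ∷ a≢c ∷ a≢d ∷ _) ∷ (b≢c ∷ b≢d ∷ _) ∷ (c≢d ∷ _) ∷ _) eq
  with second-letter a≢b (endsInQhat-step {P = []} {Q = []} refl (endsInQhat eq))
... | a<b , r₃ with third-letter (a≢c ∘ sym) (b≢c ∘ sym) a<b r₃
...   | inj₂ (a<c , c<b , r₄) = ⊥-elim (middle-third-letter-impossible 5≤n (a≢d ∘ sym) (c≢d ∘ sym) a<c c<b r₄)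
...   | inj₁ (c<a , r₄) with fourth-letter 5≤n (c≢d ∘ sym) c<a a<b r₄
...     | c<d , d<b , r₅
  with remaining-letters a<b rest (c ∷ d ∷ []) [] 5 refl ((c<d ∷ []) ∷ [] ∷ []) (AP.tail (AP.tail u)) r₅
...       | endsWithBump X lo hi sorted row≡ lo<z z<y y<b = qhatWord lo hi c<a a<b c<d d<b sorted row≡ lo<z z<y y<b
inversion []                    ()
inversion (_ ∷ [])              (s≤s ())
inversion (_ ∷ _ ∷ [])          (s≤s (s≤s ()))
inversion (_ ∷ _ ∷ _ ∷ [])      (s≤s (s≤s (s≤s ())))

-- Carrier passes over gaps and solitons

empties : ℕ → Config
empties m = replicate m nothing

empties-+ : ∀ m n c → empties (m + n) ++ c ≡ empties m ++ empties n ++ c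
empties-+ zero    n c = refl
empties-+ (suc m) n c = cong (nothing ∷_) (empties-+ m n c)

empties-∷ : ∀ m c → empties m ++ nothing ∷ c ≡ nothing ∷ empties m ++ c
empties-∷ zero    c = refl
empties-∷ (suc m) c = cong (nothing ∷_) (empties-∷ m c)

balls-empties : ∀ m c → balls (empties m ++ c) ≡ balls c
balls-empties zero    c = refl
balls-empties (suc m) c = balls-empties m c

carry-empties : ∀ m c → carry [] (empties m ++ c) ≡ empties m ++ carry [] c
carry-empties zero    c = refl
carry-empties (suc m) c = cong (nothing ∷_) (carry-empties m c)

carry-run : ∀ S R c → Sorted (S ++ R) → carry S (map just R ++ c) ≡ empties (length R) ++ carry (S ++ R) c
carry-run S []      c _      = cong (λ S′ → carry S′ c) (sym (++-identityʳ S))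
carry-run S (r ∷ R) c sorted = begin
  carry S (just r ∷ map just R ++ c)                 ≡⟨ carry-just r S (map just R ++ c) (insertRow-append S S<r) ⟩
  nothing ∷ carry (S ++ r ∷ []) (map just R ++ c)    ≡⟨ cong (nothing ∷_) (carry-run (S ++ r ∷ []) R c sorted′) ⟩
  nothing ∷ empties (length R) ++ carry ((S ++ r ∷ []) ++ R) c
    ≡⟨ cong (λ S′ → nothing ∷ empties (length R) ++ carry S′ c) (++-assoc S (r ∷ []) R) ⟩
  nothing ∷ empties (length R) ++ carry (S ++ r ∷ R) c ∎
  where
  open ≡-Reasoning
  S<r : All (_< r) S
  S<r = proj₁ (sorted-split S R sorted)
  sorted′ : Sorted ((S ++ r ∷ []) ++ R)
  sorted′ = subst Sorted (sym (++-assoc S (r ∷ []) R)) sorted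

carry-hop : ∀ {b y} g c → y < b → carry (b ∷ []) (empties g ++ just y ∷ c) ≡ just b ∷ empties g ++ carry (y ∷ []) c
carry-hop         zero    c y<b = carry-just _ (_ ∷ []) c (insertRow-bump [] y<b)
carry-hop {b} {y} (suc g) c y<b = cong (just b ∷_) (begin
  carry [] (empties g ++ just y ∷ c)            ≡⟨ carry-empties g _ ⟩
  empties g ++ nothing ∷ carry (y ∷ []) c       ≡⟨ empties-∷ g _ ⟩
  nothing ∷ empties g ++ carry (y ∷ []) c       ∎)
  where open ≡-Reasoning

prefix->-tail : ∀ {s S R} → Sorted (s ∷ S) → Prefix _>_ (s ∷ S) R → Prefix _>_ S R
prefix->-tail {S = []}     _                    _                 = []
prefix->-tail {S = _ ∷ _} ((s<s₂ ∷ _) ∷ sorted) (r<s ∷ p@(_ ∷ _)) = <-trans r<s s<s₂ ∷ prefix->-tail sorted p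

-- Each ball of R bumps the carried ball it faces in S, so S is emitted in front of R.
carry-overtaken : ∀ P {S} R g → Prefix _>_ S R → Sorted (P ++ R) → g + length S ≡ length R →
  carry (P ++ S) (map just R) ≡ map just S ++ empties g ++ map just (P ++ R)
carry-overtaken P R g [] sorted eq = begin
  carry (P ++ []) (map just R)              ≡⟨ cong₂ carry (++-identityʳ P) (sym (++-identityʳ (map just R))) ⟩
  carry P (map just R ++ [])                ≡⟨ carry-run P R [] sorted ⟩
  empties (length R) ++ map just (P ++ R)   ≡⟨ cong (λ m → empties m ++ map just (P ++ R)) (trans (sym eq) (+-identityʳ g)) ⟩
  empties g ++ map just (P ++ R)            ∎
  where open ≡-Reasoning
carry-overtaken P {s ∷ S} (r ∷ R) g (r<s ∷ p) sorted eq = begin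
  carry (P ++ s ∷ S) (just r ∷ map just R)
    ≡⟨ carry-just r (P ++ s ∷ S) (map just R) (insertRow-bumps P S (proj₁ (sorted-split P R sorted)) r<s) ⟩
  just s ∷ carry (P ++ r ∷ S) (map just R)
    ≡⟨ cong (λ P′ → just s ∷ carry P′ (map just R)) (sym (++-assoc P (r ∷ []) S)) ⟩
  just s ∷ carry ((P ++ r ∷ []) ++ S) (map just R)
    ≡⟨ cong (just s ∷_) (carry-overtaken (P ++ r ∷ []) R g p (subst Sorted (sym (++-assoc P (r ∷ []) R)) sorted)
                          (suc-injective (trans (sym (+-suc g (length S))) eq))) ⟩
  just s ∷ map just S ++ empties g ++ map just ((P ++ r ∷ []) ++ R)
    ≡⟨ cong (λ L → just s ∷ map just S ++ empties g ++ map just L) (++-assoc P (r ∷ []) R) ⟩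
  just s ∷ map just S ++ empties g ++ map just (P ++ r ∷ R) ∎
  where open ≡-Reasoning

carry-passes : ∀ S {R} f g → Sorted S → Sorted R → Prefix _>_ S R → g + length S ≡ f + length R →
  carry S (empties f ++ map just R) ≡ map just S ++ empties g ++ map just R
carry-passes S       {R} zero    g _      sR p eq = carry-overtaken [] R g p sR eq
carry-passes []      {R} (suc f) g _      sR _ eq = begin
  nothing ∷ carry [] (empties f ++ map just R)
    ≡⟨ cong (nothing ∷_) (carry-empties f (map just R)) ⟩
  nothing ∷ empties f ++ carry [] (map just R)
    ≡⟨ cong (λ c → nothing ∷ empties f ++ c) (carry-passes [] 0 (length R) [] sR [] (+-identityʳ _)) ⟩
  nothing ∷ empties f ++ empties (length R) ++ map just R
    ≡⟨ cong (nothing ∷_) (empties-+ f (length R) _) ⟨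
  empties (suc f + length R) ++ map just R
    ≡⟨ cong (λ m → empties m ++ map just R) (trans (sym (+-identityʳ g)) eq) ⟨
  empties g ++ map just R ∎
  where open ≡-Reasoning
carry-passes (s ∷ S) {R} (suc f) g sorted sR p eq =
  cong (just s ∷_) (carry-passes S f g (AP.tail sorted) sR (prefix->-tail sorted p)
                     (suc-injective (trans (sym (+-suc g (length S))) eq)))

runsAux-empties : ∀ m c → runsAux [] (empties m ++ c) ≡ runsAux [] c
runsAux-empties zero    c = refl
runsAux-empties (suc m) c = runsAux-empties m c

runsAux-< : ∀ {c b} cs xs → c < b → runsAux (c ∷ cs) (just b ∷ xs) ≡ runsAux (b ∷ c ∷ cs) xs
runsAux-< {c} {b} cs xs c<b with c <ᵇ b | <ᵇ-reflects-< c b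
... | true  | _       = refl
... | false | ofⁿ c≮b = ⊥-elim (c≮b c<b)

runsAux-≮ : ∀ {c b} cs xs → ¬ c < b → runsAux (c ∷ cs) (just b ∷ xs) ≡ reverse (c ∷ cs) ∷ runsAux (b ∷ []) xs
runsAux-≮ {c} {b} cs xs c≮b with c <ᵇ b | <ᵇ-reflects-< c b
... | true  | ofʸ c<b = ⊥-elim (c≮b c<b)
... | false | _       = refl

runsAux-sorted : ∀ c cs R → Sorted (reverse (c ∷ cs) ++ R) → runsAux (c ∷ cs) (map just R) ≡ (reverse (c ∷ cs) ++ R) ∷ []
runsAux-sorted c cs []      _      = cong (_∷ []) (sym (++-identityʳ (reverse (c ∷ cs))))
runsAux-sorted c cs (r ∷ R) sorted = begin
  runsAux (c ∷ cs) (just r ∷ map just R)      ≡⟨ runsAux-< cs (map just R) c<r ⟩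
  runsAux (r ∷ c ∷ cs) (map just R)           ≡⟨ runsAux-sorted r (c ∷ cs) R (subst Sorted (sym snoc-r) sorted) ⟩
  (reverse (r ∷ c ∷ cs) ++ R) ∷ []            ≡⟨ cong (_∷ []) snoc-r ⟩
  (reverse (c ∷ cs) ++ r ∷ R) ∷ []            ∎
  where
  open ≡-Reasoning
  snoc-r : reverse (r ∷ c ∷ cs) ++ R ≡ reverse (c ∷ cs) ++ r ∷ R
  snoc-r = trans (cong (_++ R) (unfold-reverse r (c ∷ cs))) (++-assoc (reverse (c ∷ cs)) (r ∷ []) R)
  snoc-c : reverse (c ∷ cs) ++ r ∷ R ≡ reverse cs ++ c ∷ r ∷ R
  snoc-c = trans (cong (_++ r ∷ R) (unfold-reverse c cs)) (++-assoc (reverse cs) (c ∷ []) (r ∷ R))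
  c<r : c < r
  c<r = All.head (proj₁ (proj₂ (sorted-split (reverse cs) (r ∷ R) (subst Sorted snoc-c sorted))))

concat-runsAux : ∀ cur c → concat (runsAux cur c) ≡ reverse cur ++ balls c
concat-runsAux []       []            = refl
concat-runsAux (c ∷ cs) []            = refl
concat-runsAux []       (nothing ∷ x) = concat-runsAux [] x
concat-runsAux (c ∷ cs) (nothing ∷ x) = cong (reverse (c ∷ cs) ++_) (concat-runsAux [] x)
concat-runsAux []       (just b ∷ x)  = concat-runsAux (b ∷ []) x
concat-runsAux (c ∷ cs) (just b ∷ x) with c <ᵇ b
... | true  = trans (concat-runsAux (b ∷ c ∷ cs) x)
                (trans (cong (_++ balls x) (unfold-reverse b (c ∷ cs))) (++-assoc (reverse (c ∷ cs)) (b ∷ []) (balls x)))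
... | false = cong (reverse (c ∷ cs) ++_) (concat-runsAux (b ∷ []) x)

concat-runs : ∀ c → concat (runs c) ≡ balls c
concat-runs = concat-runsAux []

iterate-suc : ∀ t (f : Config → Config) c → iterate (suc t) f c ≡ iterate t f (f c)
iterate-suc zero    f c = refl
iterate-suc (suc t) f c = cong f (iterate-suc t f c)

iterate-+ : ∀ m t (f : Config → Config) c → iterate (m + t) f c ≡ iterate m f (iterate t f c)
iterate-+ zero    t f c = refl
iterate-+ (suc m) t f c = cong f (iterate-+ m t f c)

KeepsRuns : List (List ℕ) → Config → Set
KeepsRuns rs c = All (λ r → InfixP (map just r) c) rs × (balls c ≡ concat rs)

steady-balls : ∀ n c → Steady n c → ∀ m → balls (iterate m (bbsMove n) c) ≡ balls c
steady-balls n c steady m = trans (proj₂ (steady m)) (concat-runs c)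

runsAux-pair-then-run : ∀ {u v} f R → u < v → Sorted R → Prefix _>_ (u ∷ v ∷ []) R →
  runsAux (v ∷ u ∷ []) (empties f ++ map just R) ≡ (u ∷ v ∷ []) ∷ R ∷ []
runsAux-pair-then-run zero (r ∷ R) u<v sorted (r<u ∷ _) =
  trans (runsAux-≮ (_ ∷ []) (map just R) (<⇒≯ (<-trans r<u u<v)))
        (cong ((_ ∷ _ ∷ []) ∷_) (runsAux-sorted r [] R sorted))
runsAux-pair-then-run (suc f) (r ∷ R) u<v sorted _ =
  cong ((_ ∷ _ ∷ []) ∷_) (trans (runsAux-empties f (map just (r ∷ R))) (runsAux-sorted r [] R sorted))

-- Collision of the pair a b with the ball y

overtakes-y : ∀ {z y} lo hi → All (_< z) lo → z < y → Prefix _>_ (y ∷ []) (lo ++ z ∷ hi)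
overtakes-y []      hi []        z<y = z<y ∷ []
overtakes-y (_ ∷ _) hi (l<z ∷ _) z<y = <-trans l<z z<y ∷ []

overtakes-yb : ∀ {c d X z y b} lo hi → c ∷ d ∷ X ≡ lo ++ y ∷ hi → All (_< z) lo → z < y → d < b → y < b →
  Prefix _>_ (y ∷ b ∷ []) (lo ++ z ∷ hi)
overtakes-yb []           _ refl []              z<y d<b _   = z<y ∷ d<b ∷ []
overtakes-yb (_ ∷ [])     _ refl (c<z ∷ [])      z<y _   y<b = <-trans c<z z<y ∷ <-trans z<y y<b ∷ []
overtakes-yb (_ ∷ _ ∷ _)  _ refl (c<z ∷ _)       z<y d<b _   = <-trans c<z z<y ∷ d<b ∷ []

overtakes-ay : ∀ {c d X z y a} lo hi → c ∷ d ∷ X ≡ lo ++ y ∷ hi → All (_< z) lo → z < y → c < a → c < y →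
  Prefix _>_ (a ∷ y ∷ []) (lo ++ z ∷ hi)
overtakes-ay []           _ refl _               _   _   c<c = ⊥-elim (<-irrefl refl c<c)
overtakes-ay (_ ∷ [])     _ refl _               z<y c<a _   = c<a ∷ z<y ∷ []
overtakes-ay (_ ∷ _ ∷ _)  _ refl (_ ∷ d<z ∷ _)   z<y c<a _   = c<a ∷ <-trans d<z z<y ∷ []

record PairCollision (a b y : ℕ) (R′ : List ℕ) : Set where
  field
    s u v        : ℕ
    collide      : insertRow y (a ∷ b ∷ []) ≡ (just s , u ∷ v ∷ [])
    u<s          : u < s
    u<v          : u < v
    uv-overtaken : Prefix _>_ (u ∷ v ∷ []) R′
    diverges     : _≢_ {A = List ℕ} (s ∷ u ∷ []) (a ∷ b ∷ [])

pairCollision : ∀ {a b c d X z y} lo hi → c < a → a < b → d < b → c ∷ d ∷ X ≡ lo ++ y ∷ hi →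
  All (_< z) lo → z < y → y < b → y ≢ a → PairCollision a b y (lo ++ z ∷ hi)
pairCollision {a} {b} {y = y} lo hi c<a a<b d<b row≡ lo<z z<y y<b y≢a with y <? a
... | yes y<a = record
  { s = a ; u = y ; v = b
  ; collide      = insertRow-bump (b ∷ []) y<a
  ; u<s          = y<a
  ; u<v          = y<b
  ; uv-overtaken = overtakes-yb lo hi row≡ lo<z z<y d<b y<b
  ; diverges     = λ eq → <-irrefl (∷-injectiveˡ (∷-injectiveʳ eq)) y<b
  }
... | no y≮a = record
  { s = b ; u = a ; v = y
  ; collide      = insertRow-pass y≮a (insertRow-bump [] y<b)
  ; u<s          = a<b
  ; u<v          = a<y
  ; uv-overtaken = overtakes-ay lo hi row≡ lo<z z<y c<a (<-trans c<a a<y)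
  ; diverges     = λ eq → <-irrefl (sym (∷-injectiveˡ eq)) a<b
  }
  where
  a<y : a < y
  a<y = ≮∧≢⇒> y≮a y≢a

module Collision
  (a b y k : ℕ) (R′ : List ℕ)
  (R′-sorted : Sorted R′) (length-R′ : length R′ ≡ 2 + k)
  (a<b : a < b) (y<b : y < b) (y-overtaken : Prefix _>_ (y ∷ []) R′)
  (pair-collision : PairCollision a b y R′)
  where

  open PairCollision pair-collision

  approaching : ℕ → ℕ → ℕ → Config
  approaching p g h = empties p ++ just a ∷ just b ∷ empties g ++ just y ∷ empties h ++ map just R′

  separated : ℕ → ℕ → ℕ → Config
  separated q e f = empties q ++ just s ∷ empties e ++ just u ∷ just v ∷ empties f ++ map just R′

  carry-ab : ∀ c → carry [] (just a ∷ just b ∷ c) ≡ nothing ∷ nothing ∷ carry (a ∷ b ∷ []) c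
  carry-ab c = cong (nothing ∷_) (carry-just b (a ∷ []) c (insertRow-pass (<⇒≯ a<b) refl))

  y-passes : ∀ h → carry (y ∷ []) (empties h ++ map just R′) ≡ just y ∷ empties (h + suc k) ++ map just R′
  y-passes h = carry-passes (y ∷ []) h (h + suc k) ([] ∷ []) R′-sorted y-overtaken (begin
    h + suc k + 1        ≡⟨ +-assoc h (suc k) 1 ⟩
    h + suc (k + 1)      ≡⟨ cong (λ m → h + suc m) (+-comm k 1) ⟩
    h + (2 + k)          ≡⟨ cong (h +_) length-R′ ⟨
    h + length R′        ∎)
    where open ≡-Reasoning

  uv-passes : ∀ f → carry (u ∷ v ∷ []) (empties f ++ map just R′) ≡ just u ∷ just v ∷ empties (f + k) ++ map just R′
  uv-passes f = carry-passes (u ∷ v ∷ []) f (f + k) ((u<v ∷ []) ∷ [] ∷ []) R′-sorted uv-overtaken (begin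
    f + k + 2            ≡⟨ +-assoc f k 2 ⟩
    f + (k + 2)          ≡⟨ cong (f +_) (+-comm k 2) ⟩
    f + (2 + k)          ≡⟨ cong (f +_) length-R′ ⟨
    f + length R′        ∎)
    where open ≡-Reasoning

  approach-step : ∀ p g h → carry [] (approaching p (suc g) h) ≡ approaching (p + 2) g (h + suc k)
  approach-step p g h = begin
    carry [] (empties p ++ just a ∷ just b ∷ nothing ∷ empties g ++ just y ∷ rest)
      ≡⟨ carry-empties p _ ⟩
    empties p ++ carry [] (just a ∷ just b ∷ nothing ∷ empties g ++ just y ∷ rest)
      ≡⟨ cong (empties p ++_) (carry-ab (nothing ∷ empties g ++ just y ∷ rest)) ⟩
    empties p ++ nothing ∷ nothing ∷ just a ∷ carry (b ∷ []) (empties g ++ just y ∷ rest)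
      ≡⟨ cong (λ c → empties p ++ nothing ∷ nothing ∷ just a ∷ c) (carry-hop g rest y<b) ⟩
    empties p ++ nothing ∷ nothing ∷ just a ∷ just b ∷ empties g ++ carry (y ∷ []) rest
      ≡⟨ cong (λ c → empties p ++ nothing ∷ nothing ∷ just a ∷ just b ∷ empties g ++ c) (y-passes h) ⟩
    empties p ++ nothing ∷ nothing ∷ just a ∷ just b ∷ empties g ++ just y ∷ empties (h + suc k) ++ map just R′
      ≡⟨ empties-+ p 2 _ ⟨
    approaching (p + 2) g (h + suc k) ∎
    where
    open ≡-Reasoning
    rest : Config
    rest = empties h ++ map just R′

  collision-step : ∀ p h → carry [] (approaching p 0 h) ≡ separated (p + 2) 0 (h + k)
  collision-step p h = begin
    carry [] (empties p ++ just a ∷ just b ∷ just y ∷ rest)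
      ≡⟨ carry-empties p _ ⟩
    empties p ++ carry [] (just a ∷ just b ∷ just y ∷ rest)
      ≡⟨ cong (empties p ++_) (carry-ab (just y ∷ rest)) ⟩
    empties p ++ nothing ∷ nothing ∷ carry (a ∷ b ∷ []) (just y ∷ rest)
      ≡⟨ cong (λ c → empties p ++ nothing ∷ nothing ∷ c) (carry-just y (a ∷ b ∷ []) rest collide) ⟩
    empties p ++ nothing ∷ nothing ∷ just s ∷ carry (u ∷ v ∷ []) rest
      ≡⟨ cong (λ c → empties p ++ nothing ∷ nothing ∷ just s ∷ c) (uv-passes h) ⟩
    empties p ++ nothing ∷ nothing ∷ just s ∷ just u ∷ just v ∷ empties (h + k) ++ map just R′
      ≡⟨ empties-+ p 2 _ ⟨
    separated (p + 2) 0 (h + k) ∎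
    where
    open ≡-Reasoning
    rest : Config
    rest = empties h ++ map just R′

  separated-step : ∀ q e f → carry [] (separated q e f) ≡ separated (q + 1) (suc e) (f + k)
  separated-step q e f = begin
    carry [] (empties q ++ just s ∷ empties e ++ just u ∷ just v ∷ rest)
      ≡⟨ carry-empties q _ ⟩
    empties q ++ nothing ∷ carry (s ∷ []) (empties e ++ just u ∷ just v ∷ rest)
      ≡⟨ cong (λ c → empties q ++ nothing ∷ c) (carry-hop e (just v ∷ rest) u<s) ⟩
    empties q ++ nothing ∷ just s ∷ empties e ++ carry (u ∷ []) (just v ∷ rest)
      ≡⟨ cong (λ c → empties q ++ nothing ∷ just s ∷ empties e ++ c)
              (carry-just v (u ∷ []) rest (insertRow-pass (<⇒≯ u<v) refl)) ⟩
    empties q ++ nothing ∷ just s ∷ empties e ++ nothing ∷ carry (u ∷ v ∷ []) rest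
      ≡⟨ cong (λ c → empties q ++ nothing ∷ just s ∷ empties e ++ nothing ∷ c) (uv-passes f) ⟩
    empties q ++ nothing ∷ just s ∷ empties e ++ nothing ∷ just u ∷ just v ∷ empties (f + k) ++ map just R′
      ≡⟨ cong (λ c → empties q ++ nothing ∷ just s ∷ c) (empties-∷ e _) ⟩
    empties q ++ nothing ∷ just s ∷ nothing ∷ empties e ++ just u ∷ just v ∷ empties (f + k) ++ map just R′
      ≡⟨ empties-+ q 1 _ ⟨
    separated (q + 1) (suc e) (f + k) ∎
    where
    open ≡-Reasoning
    rest : Config
    rest = empties f ++ map just R′

  approach-phase : ∀ j g p h → ∃₂ λ p′ h′ → iterate j (carry []) (approaching p (j + g) h) ≡ approaching p′ g h′
  approach-phase zero    g p h = p , h , refl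
  approach-phase (suc j) g p h =
    let p′ , h′ , eq = approach-phase j g (p + 2) (h + suc k) in
    p′ , h′ , trans (iterate-suc j (carry []) _) (trans (cong (iterate j (carry [])) (approach-step p (j + g) h)) eq)

  separated-phase : ∀ m q e f → ∃₂ λ q′ f′ → iterate m (carry []) (separated q e f) ≡ separated q′ (m + e) f′
  separated-phase zero    q e f = q , f , refl
  separated-phase (suc m) q e f =
    let q′ , f′ , eq = separated-phase m q e f in
    q′ + 1 , f′ + k , trans (cong (carry []) eq) (separated-step q′ (m + e) f′)

  balls-approaching : ∀ p g h → balls (approaching p g h) ≡ a ∷ b ∷ y ∷ R′
  balls-approaching p g h = begin
    balls (empties p ++ just a ∷ just b ∷ empties g ++ just y ∷ empties h ++ map just R′)
      ≡⟨ balls-empties p _ ⟩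
    a ∷ b ∷ balls (empties g ++ just y ∷ empties h ++ map just R′)
      ≡⟨ cong (λ bs → a ∷ b ∷ bs) (balls-empties g _) ⟩
    a ∷ b ∷ y ∷ balls (empties h ++ map just R′)
      ≡⟨ cong (λ bs → a ∷ b ∷ y ∷ bs) (trans (balls-empties h _) (balls-map-just R′)) ⟩
    a ∷ b ∷ y ∷ R′ ∎
    where open ≡-Reasoning

  balls-separated : ∀ q e f → balls (separated q e f) ≡ s ∷ u ∷ v ∷ R′
  balls-separated q e f = begin
    balls (empties q ++ just s ∷ empties e ++ just u ∷ just v ∷ empties f ++ map just R′)
      ≡⟨ balls-empties q _ ⟩
    s ∷ balls (empties e ++ just u ∷ just v ∷ empties f ++ map just R′)
      ≡⟨ cong (s ∷_) (balls-empties e _) ⟩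
    s ∷ u ∷ v ∷ balls (empties f ++ map just R′)
      ≡⟨ cong (λ bs → s ∷ u ∷ v ∷ bs) (trans (balls-empties f _) (balls-map-just R′)) ⟩
    s ∷ u ∷ v ∷ R′ ∎
    where open ≡-Reasoning

  runs-separated : ∀ q f → runs (separated q 0 f) ≡ (s ∷ []) ∷ (u ∷ v ∷ []) ∷ R′ ∷ []
  runs-separated q f = begin
    runsAux [] (empties q ++ just s ∷ just u ∷ just v ∷ rest)   ≡⟨ runsAux-empties q _ ⟩
    runsAux (s ∷ []) (just u ∷ just v ∷ rest)                    ≡⟨ runsAux-≮ [] _ (<⇒≯ u<s) ⟩
    (s ∷ []) ∷ runsAux (u ∷ []) (just v ∷ rest)                  ≡⟨ cong ((s ∷ []) ∷_) (runsAux-< [] rest u<v) ⟩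
    (s ∷ []) ∷ runsAux (v ∷ u ∷ []) rest
      ≡⟨ cong ((s ∷ []) ∷_) (runsAux-pair-then-run f R′ u<v R′-sorted uv-overtaken) ⟩
    (s ∷ []) ∷ (u ∷ v ∷ []) ∷ R′ ∷ []                            ∎
    where
    open ≡-Reasoning
    rest : Config
    rest = empties f ++ map just R′

  runs-infix-separated : ∀ q e f →
    All (λ r → InfixP (map just r) (separated q e f)) ((s ∷ []) ∷ (u ∷ v ∷ []) ∷ R′ ∷ [])
  runs-infix-separated q e f =
      (empties q , _ , refl)
    ∷ (empties q ++ just s ∷ empties e , empties f ++ map just R′ , sym (++-assoc (empties q) (just s ∷ empties e) _))
    ∷ (before-R′ , [] , R′-last)
    ∷ []
    where
    before-R′ : Config
    before-R′ = empties q ++ just s ∷ empties e ++ just u ∷ just v ∷ empties f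
    R′-last : separated q e f ≡ before-R′ ++ map just R′ ++ []
    R′-last = begin
      empties q ++ just s ∷ empties e ++ just u ∷ just v ∷ empties f ++ map just R′
        ≡⟨ cong (λ c → empties q ++ just s ∷ c) (++-assoc (empties e) (just u ∷ just v ∷ empties f) _) ⟨
      empties q ++ just s ∷ (empties e ++ just u ∷ just v ∷ empties f) ++ map just R′
        ≡⟨ ++-assoc (empties q) (just s ∷ empties e ++ just u ∷ just v ∷ empties f) _ ⟨
      before-R′ ++ map just R′
        ≡⟨ cong (before-R′ ++_) (++-identityʳ (map just R′)) ⟨
      before-R′ ++ map just R′ ++ [] ∎
      where open ≡-Reasoning

  separated-keeps-runs : ∀ q f q′ e f′ → KeepsRuns (runs (separated q 0 f)) (separated q′ e f′)
  separated-keeps-runs q f q′ e f′ rewrite runs-separated q f =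
    runs-infix-separated q′ e f′ ,
    trans (balls-separated q′ e f′) (cong (λ R → s ∷ u ∷ v ∷ R) (sym (++-identityʳ R′)))

  separated-steady : ∀ n q f → IsPerm n (balls (separated q 0 f)) → Steady n (separated q 0 f)
  separated-steady n q f bal m with separated-phase m q 0 f
  ... | q′ , f′ , eq =
    subst (KeepsRuns (runs (separated q 0 f))) (sym (trans (iterate-bbsMove≡carry n _ bal m) eq))
      (separated-keeps-runs q f q′ (m + 0) f′)

  module FromWord (n : ℕ) (w′ : List ℕ) (perm : IsPerm n (a ∷ b ∷ w′))
    (first-move : carry [] (map just (a ∷ b ∷ w′)) ≡ approaching 2 k 0) where

    w : List ℕ
    w = a ∷ b ∷ w′

    balls-w : IsPerm n (balls (map just w))
    balls-w = subst (IsPerm n) (sym (balls-map-just w)) perm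

    carried : ℕ → Config
    carried t = iterate t (carry []) (map just w)

    carried-approaching : ∀ j g → j + g ≡ k → ∃₂ λ p h → carried (suc j) ≡ approaching p g h
    carried-approaching j g j+g≡k =
      let p , h , eq = approach-phase j g 2 0 in
      p , h , (begin
        carried (suc j)                                 ≡⟨ iterate-suc j (carry []) _ ⟩
        iterate j (carry []) (carry [] (map just w))    ≡⟨ cong (iterate j (carry [])) first-move ⟩
        iterate j (carry []) (approaching 2 k 0)        ≡⟨ cong (λ g′ → iterate j (carry []) (approaching 2 g′ 0)) j+g≡k ⟨
        iterate j (carry []) (approaching 2 (j + g) 0)  ≡⟨ eq ⟩
        approaching p g h                               ∎)
      where open ≡-Reasoning

    carried-separated : ∃₂ λ q f → carried (2 + k) ≡ separated q 0 f
    carried-separated =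
      let p , h , eq = carried-approaching k 0 (+-identityʳ k) in
      p + 2 , h + k , trans (cong (carry []) eq) (collision-step p h)

    leading-pair : ∀ t → t ≤ suc k → take 2 (balls (carried t)) ≡ a ∷ b ∷ []
    leading-pair zero    _       = cong (take 2) (balls-map-just w)
    leading-pair (suc j) (s≤s j≤k) =
      let p , h , eq = carried-approaching j (k ∸ j) (m+[n∸m]≡n j≤k) in
      cong (take 2) (trans (cong balls eq) (balls-approaching p (k ∸ j) h))

    steady-at-collision : Steady n (state n w (2 + k))
    steady-at-collision =
      let q , f , eq = carried-separated in
      subst (Steady n) (sym (trans (iterate-bbsMove≡carry n (map just w) balls-w (2 + k)) eq))
        (separated-steady n q f (subst (IsPerm n ∘ balls) eq (isPerm-iterate-carry (map just w) balls-w (2 + k))))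

    unsteady-before-collision : ∀ t → t < 2 + k → ¬ Steady n (state n w t)
    unsteady-before-collision t t<2+k steady with carried-separated
    ... | q , f , eq = diverges (begin
      s ∷ u ∷ []
        ≡⟨ cong (take 2) (balls-separated q 0 f) ⟨
      take 2 (balls (separated q 0 f))
        ≡⟨ cong (take 2 ∘ balls) (trans (iterate-bbsMove≡carry n _ balls-w (2 + k)) eq) ⟨
      take 2 (balls (state n w (2 + k)))
        ≡⟨ cong (λ m → take 2 (balls (state n w m))) (m∸n+n≡m (<⇒≤ t<2+k)) ⟨
      take 2 (balls (state n w ((2 + k ∸ t) + t)))
        ≡⟨ cong (take 2 ∘ balls) (iterate-+ (2 + k ∸ t) t (bbsMove n) _) ⟩
      take 2 (balls (iterate (2 + k ∸ t) (bbsMove n) (state n w t)))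
        ≡⟨ cong (take 2) (steady-balls n (state n w t) steady (2 + k ∸ t)) ⟩
      take 2 (balls (state n w t))
        ≡⟨ cong (take 2 ∘ balls) (iterate-bbsMove≡carry n _ balls-w t) ⟩
      take 2 (balls (carried t))
        ≡⟨ leading-pair t (≤-pred t<2+k) ⟩
      a ∷ b ∷ [] ∎)
      where open ≡-Reasoning

    steady-state-time : SteadyStateTime n w (2 + k)
    steady-state-time = steady-at-collision , unsteady-before-collision

first-move : ∀ {a b c d X z y} lo hi → c < a → a < b → c < d → d < b → Sorted (c ∷ d ∷ X) →
  c ∷ d ∷ X ≡ lo ++ y ∷ hi → All (_< z) lo → z < y →
  carry [] (map just (a ∷ b ∷ c ∷ d ∷ X ++ z ∷ [])) ≡
    nothing ∷ nothing ∷ just a ∷ just b ∷ empties (length X) ++ just y ∷ map just (lo ++ z ∷ hi)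
first-move {a} {b} {c} {d} {X} {z} {y} lo hi c<a a<b c<d d<b sorted row≡ lo<z z<y = begin
  carry [] (just a ∷ just b ∷ just c ∷ just d ∷ map just (X ++ z ∷ []))
    ≡⟨ cong (nothing ∷_) (carry-just b (a ∷ []) (just c ∷ just d ∷ map just (X ++ z ∷ []))
                                      (insertRow-pass (<⇒≯ a<b) refl)) ⟩
  nothing ∷ nothing ∷ carry (a ∷ b ∷ []) (just c ∷ just d ∷ map just (X ++ z ∷ []))
    ≡⟨ cong (λ t → nothing ∷ nothing ∷ t)
            (carry-just c (a ∷ b ∷ []) (just d ∷ map just (X ++ z ∷ [])) (insertRow-bump (b ∷ []) c<a)) ⟩
  nothing ∷ nothing ∷ just a ∷ carry (c ∷ b ∷ []) (just d ∷ map just (X ++ z ∷ []))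
    ≡⟨ cong (λ t → nothing ∷ nothing ∷ just a ∷ t)
            (carry-just d (c ∷ b ∷ []) (map just (X ++ z ∷ [])) (insertRow-pass (<⇒≯ c<d) (insertRow-bump [] d<b))) ⟩
  nothing ∷ nothing ∷ just a ∷ just b ∷ carry (c ∷ d ∷ []) (map just (X ++ z ∷ []))
    ≡⟨ cong (λ t → nothing ∷ nothing ∷ just a ∷ just b ∷ carry (c ∷ d ∷ []) t) (map-++ just X (z ∷ [])) ⟩
  nothing ∷ nothing ∷ just a ∷ just b ∷ carry (c ∷ d ∷ []) (map just X ++ just z ∷ [])
    ≡⟨ cong (λ t → nothing ∷ nothing ∷ just a ∷ just b ∷ t) (carry-run (c ∷ d ∷ []) X (just z ∷ []) sorted) ⟩
  nothing ∷ nothing ∷ just a ∷ just b ∷ empties (length X) ++ carry (c ∷ d ∷ X) (just z ∷ [])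
    ≡⟨ cong (λ t → nothing ∷ nothing ∷ just a ∷ just b ∷ empties (length X) ++ t)
            (carry-just z (c ∷ d ∷ X) []
              (subst (λ r → insertRow z r ≡ (just y , lo ++ z ∷ hi)) (sym row≡) (insertRow-bumps lo hi lo<z z<y))) ⟩
  nothing ∷ nothing ∷ just a ∷ just b ∷ empties (length X) ++ just y ∷ map just (lo ++ z ∷ hi) ∎
  where open ≡-Reasoning

qhat-steady-state-time : ∀ {n w} → IsPerm n w → QhatWord w → SteadyStateTime n w (n ∸ 3)
qhat-steady-state-time {n} perm (qhatWord {a} {b} {c} {d} {X} {z} {y} lo hi c<a a<b c<d d<b sorted row≡ lo<z z<y y<b) =
  subst (SteadyStateTime n _) (sym n∸3≡2+k)
    (FromWord.steady-state-time n (c ∷ d ∷ X ++ z ∷ []) perm (first-move lo hi c<a a<b c<d d<b sorted row≡ lo<z z<y))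
  where
  w : List ℕ
  w = a ∷ b ∷ c ∷ d ∷ X ++ z ∷ []
  y∈row : y ∈ c ∷ d ∷ X
  y∈row = subst (y ∈_) (sym row≡) (∈-insert lo)
  y≢a : y ≢ a
  y≢a y≡a = All.lookup (AP.head (permutation-unique perm)) (there (∈-++⁺ˡ y∈row)) (sym y≡a)
  length-R′ : length (lo ++ z ∷ hi) ≡ 2 + length X
  length-R′ = trans (trans (length-++ lo) (sym (length-++ lo))) (cong length (sym row≡))
  open Collision a b y (length X) (lo ++ z ∷ hi) (sorted-replace lo hi (subst Sorted row≡ sorted) lo<z z<y) length-R′
    a<b y<b (overtakes-y lo hi lo<z z<y) (pairCollision lo hi c<a a<b d<b row≡ lo<z z<y y<b y≢a)
  n∸3≡2+k : n ∸ 3 ≡ 2 + length X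
  n∸3≡2+k = begin
    n ∸ 3                          ≡⟨ cong (_∸ 3) (trans (↭-length perm) (length-applyUpTo suc n)) ⟨
    length w ∸ 3                   ≡⟨ cong suc (length-++ X) ⟩
    suc (length X + 1)             ≡⟨ cong suc (+-comm (length X) 1) ⟩
    2 + length X                   ∎
    where open ≡-Reasoning

theorem6p7 : (n : ℕ) → 5 ≤ n → (w : List ℕ) → IsPerm n w →
    recQ w ≡ Qhat n → SteadyStateTime n w (n ∸ 3)
theorem6p7 n 5≤n w perm recQ≡Qhat =
  qhat-steady-state-time perm (inversion w (subst (5 ≤_) (sym |w|≡n) 5≤n) (permutation-unique perm)
                                           (subst (λ m → recQ w ≡ Qhat m) (sym |w|≡n) recQ≡Qhat))
  where
  |w|≡n : length w ≡ n
  |w|≡n = trans (↭-length perm) (length-applyUpTo suc n)
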